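{- Let $m\in\mathbb{Z}_{>0}$. Then $S(m)=\{(g_i,\ g_{t-i+1},\ m): i\in\{1,\dots,t\}\}$ is the set of maximal elements of $\Gamma(m)$ (with respect to the componentwise order).
   Context: Let $p$ be a prime, $\mathbb{F}=\mathbb{F}_p$, $S=\mathbb{F}[x,y]$, $\mathrm{Der}_S=S\partial_x\oplus S\partial_y$. Let $\mathcal{A}=\{H_1,H_2,H_3\}$ with $H_1=\ker x$, $H_2=\ker y$, $H_3=\ker(x+y)$, $\alpha_1=x,\alpha_2=y,\alpha_3=x+y$. For $\mu=(\mu_1,\mu_2,\mu_3)\in\mathbb{Z}_{\ge0}^3$, $D(\mathcal{A},\mu)=\{\theta\in\mathrm{Der}_S:\theta(\alpha_i)\in\alpha_i^{\mu_i}S,\ i=1,2,3\}$. Let $\Lambda(m)=\{\mu\in\mathbb{Z}_{\ge0}^3:\mu_3=m\}$, partially ordered componentwise. For $\mu\in\Lambda(m)$ let $\psi_\mu=\sum_{j=\mu_1}^{m}\binom{m}{j}x^jy^{m-j}\partial_x+\sum_{j=0}^{\mu_1-1}\binom{m}{j}x^jy^{m-j}\partial_y$ (binomial coefficients read in $\mathbb{F}_p$; empty sums are zero) and $\psi'_\mu=x^{\mu_1}y^{\mu_2}(\partial_y-\partial_x)$, and $\Gamma(m)=\{\mu\in\Lambda(m):\{\psi_\mu,\psi'_\mu\}\text{ is a basis for }D(\mathcal{A},\mu)\}$. Write the base-$p$ expansion $n=\sum_{e\ge0}c_e(n)p^e$ with $0\le c_e(n)<p$. Let $G_m=\{g\in\mathbb{Z}_{\ge0}:c_e(g)\le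 c_e(m)\text{ for all }e\}=\{g_0,\dots,g_t\}$ with $0=g_0<g_1<\dots<g_t=m$. -}

module Defs where

open import Data.Nat using (ℕ; zero; suc; _+_; _*_; _∸_; _^_; _≤_; _<_; NonZero; _≟_)
open import Data.Nat.DivMod using (_/_; _%_)
open import Data.Nat.Properties using (m^n≢0)
open import Data.Nat.Combinatorics using (_C_)
open import Data.List using (List; []; _∷_; map; foldr; upTo; length)
open import Data.Product using (Σ; ∃; ∃-syntax; _×_; _,_)
open import Relation.Binary.PropositionalEquality using (_≡_)
open import Relation.Nullary using (yes; no)

-- Elements of 𝔽_p are represented by natural numbers, compared mod p.

_≡[_]_ : ℕ → ℕ → ℕ → Set
a ≡[ p ] b = ∃[ k ] ∃[ l ] a + k * p ≡ b + l * p

-- Polynomials in 𝔽_p[x,y]: coefficient functions  f i j = coeff of x^i y^j,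
-- with finite support (mod p), compared coefficientwise mod p.

Pol : Set
Pol = ℕ → ℕ → ℕ

IsPoly : ℕ → Pol → Set
IsPoly p f = ∃[ d ] (∀ i j → d < i + j → f i j ≡[ p ] 0)

_≈[_]_ : Pol → ℕ → Pol → Set
f ≈[ p ] g = ∀ i j → f i j ≡[ p ] g i j

0P : Pol
0P _ _ = 0

_+P_ : Pol → Pol → Pol
(f +P g) i j = f i j + g i j

scale : ℕ → Pol → Pol
scale c f i j = c * f i j

ΣN : ℕ → (ℕ → ℕ) → ℕ
ΣN n h = foldr _+_ 0 (map h (upTo (suc n)))

_*P_ : Pol → Pol → Pol
(f *P g) i j = ΣN i λ a → ΣN j λ b → f a b * g (i ∸ a) (j ∸ b)

mono : ℕ → ℕ → Pol
mono a b i j with i ≟ a | j ≟ b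
... | yes _ | yes _ = 1
... | _     | _     = 0

_^P_ : Pol → ℕ → Pol
f ^P zero  = mono 0 0
f ^P suc n = f *P (f ^P n)

X Y XY : Pol
X  = mono 1 0
Y  = mono 0 1
XY = X +P Y

sumP : List Pol → Pol
sumP = foldr _+P_ 0P

rangeLt : ℕ → ℕ → List ℕ
rangeLt a b = map (a +_) (upTo (b ∸ a))

Divides : ℕ → Pol → Pol → Set
Divides p g f = ∃[ h ] (IsPoly p h × f ≈[ p ] (g *P h))

-- Derivations θ = f ∂x + g ∂y, represented by the pair (f , g).
-- θ(x) = f, θ(y) = g, θ(x+y) = f + g.

Der : Set
Der = Pol × Pol

_≈D[_]_ : Der → ℕ → Der → Set
(f , g) ≈D[ p ] (f' , g') = (f ≈[ p ] f') × (g ≈[ p ] g')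

IsDer : ℕ → Der → Set
IsDer p (f , g) = IsPoly p f × IsPoly p g

InD : ℕ → ℕ → ℕ → ℕ → Der → Set
InD p μ₁ μ₂ m (f , g) =
  IsPoly p f × IsPoly p g ×
  Divides p (X ^P μ₁) f × Divides p (Y ^P μ₂) g × Divides p (XY ^P m) (f +P g)

comb : Pol → Pol → Der → Der → Der
comb a b (f₁ , g₁) (f₂ , g₂) = ((a *P f₁) +P (b *P f₂)) , ((a *P g₁) +P (b *P g₂))

IsBasis : ℕ → ℕ → ℕ → ℕ → Der → Der → Set
IsBasis p μ₁ μ₂ m θ₁ θ₂ =
  InD p μ₁ μ₂ m θ₁ × InD p μ₁ μ₂ m θ₂ ×
  (∀ θ → InD p μ₁ μ₂ m θ →
     ∃[ a ] ∃[ b ] (IsPoly p a × IsPoly p b × θ ≈D[ p ] comb a b θ₁ θ₂)) ×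
  (∀ a b → IsPoly p a → IsPoly p b → comb a b θ₁ θ₂ ≈D[ p ] (0P , 0P) →
     (a ≈[ p ] 0P) × (b ≈[ p ] 0P))

term : ℕ → ℕ → Pol
term m j = scale (m C j) ((X ^P j) *P (Y ^P (m ∸ j)))

ψ : ℕ → ℕ → Der
ψ m μ₁ = sumP (map (term m) (rangeLt μ₁ (suc m))) , sumP (map (term m) (rangeLt 0 μ₁))

-- ψ'_μ = x^μ₁ y^μ₂ (∂y − ∂x);  −1 is represented by p ∸ 1
ψ' : ℕ → ℕ → ℕ → Der
ψ' p μ₁ μ₂ = scale (p ∸ 1) ((X ^P μ₁) *P (Y ^P μ₂)) , ((X ^P μ₁) *P (Y ^P μ₂))

InΓ : ℕ → ℕ → ℕ → ℕ → Set
InΓ p m μ₁ μ₂ = IsBasis p μ₁ μ₂ m (ψ m μ₁) (ψ' p μ₁ μ₂)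

MaximalΓ : ℕ → ℕ → ℕ → ℕ → Set
MaximalΓ p m μ₁ μ₂ =
  InΓ p m μ₁ μ₂ ×
  (∀ ν₁ ν₂ → InΓ p m ν₁ ν₂ → μ₁ ≤ ν₁ → μ₂ ≤ ν₂ → (ν₁ ≡ μ₁ × ν₂ ≡ μ₂))

digit : (p : ℕ) → .{{NonZero p}} → ℕ → ℕ → ℕ
digit p e n = (n / p ^ e) {{m^n≢0 p e}} % p

InG : (p : ℕ) → .{{NonZero p}} → ℕ → ℕ → Set
InG p m g = ∀ e → digit p e g ≤ digit p e m

-- nth element of a list (0-indexed, default 0 out of range)
nth : List ℕ → ℕ → ℕ
nth []       _       = 0
nth (x ∷ xs) zero    = x
nth (x ∷ xs) (suc i) = nth xs i

-- (a, b, m) ∈ S(m), where gs = [g₀, …, g_t]:  ∃ i ∈ {1..t}, a = g_i, b = g_{t-i+1}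
InS : List ℕ → ℕ → ℕ → Set
InS gs a b =
  ∃[ i ] (1 ≤ i × i ≤ t × a ≡ nth gs i × b ≡ nth gs (t + 1 ∸ i))
  where t = length gs ∸ 1

{-# OPTIONS --safe #-}
module Submission where

-- By Lucas' theorem, m C i is nonzero mod p exactly when i ∈ G_m. The two components of ψ add up
-- to (x+y)^m, and ψʸ collects the terms (m C i) x^i y^(m-i) with i < μ₁, so y^μ₂ divides ψʸ exactly
-- when m C i ≡ 0 for all i < μ₁ with m - i < μ₂. This condition already makes {ψ, ψ′} a basis:
-- θ = c ψ + b ψ′ with c = (θx + θy) / (x+y)^m and b = (θy - c ψʸ) / (x^μ₁ y^μ₂), and the pair is
-- independent because (x+y)^m is not a zero divisor. Hence μ ∈ Γ(m) iff μ₂ + g ≤ m for every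
-- g ∈ G_m below μ₁. The maximal points of this staircase are its corners (g_(k+1), m - g_k), and
-- the symmetry g ↦ m - g of G_m gives m - g_k = g_(t-k).

open import Defs
open import Data.Nat
open import Data.Nat.Properties
open import Data.Nat.DivMod
open import Data.Nat.Divisibility using (_∣_; _∤_; divides; ∣-trans; m∣m*n; ∣⇒≤; ∣1⇒≡1; n∣m⇒m%n≡0; m%n≡0⇒n∣m)
open import Data.Nat.Primality using (Prime; euclidsLemma; prime⇒nonTrivial; ¬prime[0])
open import Data.Nat.Combinatorics
open import Data.Nat.Tactic.RingSolver using (solve-∀)
open import Data.Product using (∃-syntax; _×_; _,_; proj₁; proj₂)
open import Data.Product.Function.NonDependent.Propositional using (_×-⇔_)
open import Data.Sum using (_⊎_; inj₁; inj₂; [_,_]′)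
open import Data.Empty using (⊥-elim)
open import Data.Nat.Induction using (<-rec)
open import Data.List using (List; []; _∷_; map; foldr; upTo; applyUpTo; length)
open import Data.List.Properties using (map-applyUpTo)
open import Data.List.Relation.Unary.Linked using (Linked; [-]; _∷_)
open import Data.List.Relation.Unary.Any using (here; there)
open import Data.List.Membership.Propositional using (_∈_)
open import Function.Base using (_∘_)
open import Function.Bundles using (_⇔_; mk⇔; Equivalence)
open import Function.Properties.Equivalence using () renaming (sym to ⇔-sym; trans to ⇔-trans)
open import Relation.Nullary using (¬_; Dec; yes; no)
open import Relation.Binary.Bundles using (Setoid)
open import Relation.Binary.PropositionalEquality
  using (_≡_; _≢_; refl; sym; trans; cong; cong₂; subst; subst₂; ≢-sym; module ≡-Reasoning)
import Relation.Binary.Reasoning.Setoid as SetoidReasoning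

module Congruence (p-1 : ℕ) where

  p : ℕ
  p = suc p-1

  infix 4 _≈_ _≉0
  record _≈_ (a b : ℕ) : Set where
    constructor mod-≡
    field %-≡ : a % p ≡ b % p
  open _≈_ public

  _≉0 : ℕ → Set
  a ≉0 = ¬ (a ≈ 0)

  ≈-reflexive : ∀ {a b} → a ≡ b → a ≈ b
  ≈-reflexive a≡b = mod-≡ (cong (_% p) a≡b)

  ≈-refl : ∀ {a} → a ≈ a
  ≈-refl = mod-≡ refl

  ≈-sym : ∀ {a b} → a ≈ b → b ≈ a
  ≈-sym (mod-≡ e) = mod-≡ (sym e)

  ≈-trans : ∀ {a b c} → a ≈ b → b ≈ c → a ≈ c
  ≈-trans (mod-≡ e) (mod-≡ f) = mod-≡ (trans e f)

  ≈-setoid : Setoid _ _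
  ≈-setoid = record
    { Carrier = ℕ ; _≈_ = _≈_
    ; isEquivalence = record { refl = ≈-refl ; sym = ≈-sym ; trans = ≈-trans } }

  module ≈-Reasoning = SetoidReasoning ≈-setoid

  +-cong : ∀ {a a′ b b′} → a ≈ a′ → b ≈ b′ → a + b ≈ a′ + b′
  +-cong {a} {a′} {b} {b′} (mod-≡ e) (mod-≡ f) = mod-≡ (begin
    (a + b) % p              ≡⟨ %-distribˡ-+ a b p ⟩
    (a % p + b % p) % p      ≡⟨ cong₂ (λ x y → (x + y) % p) e f ⟩
    (a′ % p + b′ % p) % p    ≡⟨ %-distribˡ-+ a′ b′ p ⟨
    (a′ + b′) % p            ∎)
    where open ≡-Reasoning

  *-cong : ∀ {a a′ b b′} → a ≈ a′ → b ≈ b′ → a * b ≈ a′ * b′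
  *-cong {a} {a′} {b} {b′} (mod-≡ e) (mod-≡ f) = mod-≡ (begin
    (a * b) % p              ≡⟨ %-distribˡ-* a b p ⟩
    (a % p * (b % p)) % p    ≡⟨ cong₂ (λ x y → (x * y) % p) e f ⟩
    (a′ % p * (b′ % p)) % p  ≡⟨ %-distribˡ-* a′ b′ p ⟨
    (a′ * b′) % p            ∎)
    where open ≡-Reasoning

  *-zeroˡ-≈ : ∀ {a} b → a ≈ 0 → a * b ≈ 0
  *-zeroˡ-≈ b a≈0 = *-cong a≈0 (≈-refl {b})

  *-zeroʳ-≈ : ∀ a {b} → b ≈ 0 → a * b ≈ 0
  *-zeroʳ-≈ a b≈0 = ≈-trans (*-cong (≈-refl {a}) b≈0) (≈-reflexive (*-zeroʳ a))

  +-multiple-≈ : ∀ a k → a + k * p ≈ a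
  +-multiple-≈ a k = mod-≡ ([m+kn]%n≡m%n a k p)

  -- p-1 stands for −1, so this is subtraction modulo p.
  infixl 6 _−_
  _−_ : ℕ → ℕ → ℕ
  a − b = a + p-1 * b

  p-1*x+x≈0 : ∀ x → p-1 * x + x ≈ 0
  p-1*x+x≈0 x = ≈-trans (≈-reflexive (trans (+-comm (p-1 * x) x) (*-comm p x))) (+-multiple-≈ 0 x)

  +-≈0ʳ : ∀ a {b} → b ≈ 0 → a + b ≈ a
  +-≈0ʳ a b≈0 = ≈-trans (+-cong (≈-refl {a}) b≈0) (≈-reflexive (+-identityʳ a))

  ≈⇒−≈0 : ∀ {a b} → a ≈ b → a − b ≈ 0
  ≈⇒−≈0 {a} {b} a≈b = ≈-trans (+-cong a≈b (≈-refl {p-1 * b})) (≈-trans (≈-reflexive (+-comm b _)) (p-1*x+x≈0 b))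

  +-−-≈ : ∀ a b → b + (a − b) ≈ a
  +-−-≈ a b = ≈-trans (≈-reflexive (trans (+-comm b _) (+-assoc a _ b))) (+-≈0ʳ a (p-1*x+x≈0 b))

  −-swap-≈ : ∀ {f g a b} → f + g ≈ a + b → a − (g − b) ≈ f
  −-swap-≈ {f} {g} {a} {b} f+g≈a+b = begin
    a − (g − b)                            ≈⟨ +-cong a≈f+[g−b] (≈-refl {p-1 * (g − b)}) ⟩
    f + (g − b) + p-1 * (g − b)            ≡⟨ +-assoc f (g − b) _ ⟩
    f + ((g − b) − (g − b))                ≈⟨ +-≈0ʳ f (≈⇒−≈0 (≈-refl {g − b})) ⟩
    f                                      ∎
    where
      open ≈-Reasoning
      a≈f+[g−b] : a ≈ f + (g − b)
      a≈f+[g−b] = begin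
        a                      ≈⟨ +-≈0ʳ a (≈⇒−≈0 (≈-refl {b})) ⟨
        a + (b − b)            ≡⟨ +-assoc a b _ ⟨
        a + b + p-1 * b        ≈⟨ +-cong f+g≈a+b (≈-refl {p-1 * b}) ⟨
        f + g + p-1 * b        ≡⟨ +-assoc f g _ ⟩
        f + (g − b)            ∎

  ≈0? : ∀ a → Dec (a ≈ 0)
  ≈0? a with a % p ≟ 0
  ... | yes a%p≡0 = yes (mod-≡ a%p≡0)
  ... | no a%p≢0  = no (a%p≢0 ∘ %-≡)

  ∣⇒≈0 : ∀ {a} → p ∣ a → a ≈ 0
  ∣⇒≈0 {a} p∣a = mod-≡ (n∣m⇒m%n≡0 a p p∣a)

  ≈0⇒∣ : ∀ {a} → a ≈ 0 → p ∣ a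
  ≈0⇒∣ {a} (mod-≡ e) = m%n≡0⇒n∣m a p e

  ≡[p]⇒≈ : ∀ {a b} → a ≡[ p ] b → a ≈ b
  ≡[p]⇒≈ {a} {b} (k , l , e) =
    ≈-trans (≈-sym (+-multiple-≈ a k)) (≈-trans (≈-reflexive e) (+-multiple-≈ b l))

  ≈⇒≡[p] : ∀ {a b} → a ≈ b → a ≡[ p ] b
  ≈⇒≡[p] {a} {b} (mod-≡ e) = b / p , a / p , (begin
    a + b / p * p                  ≡⟨ cong (_+ b / p * p) (m≡m%n+[m/n]*n a p) ⟩
    a % p + a / p * p + b / p * p  ≡⟨ cong (λ r → r + a / p * p + b / p * p) e ⟩
    b % p + a / p * p + b / p * p  ≡⟨ swap (b % p) (a / p * p) (b / p * p) ⟩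
    b % p + b / p * p + a / p * p  ≡⟨ cong (_+ a / p * p) (m≡m%n+[m/n]*n b p) ⟨
    b + a / p * p                  ∎)
    where
      open ≡-Reasoning
      swap : ∀ x y z → x + y + z ≡ x + z + y
      swap = solve-∀

module Lucas (p-1 : ℕ) (p-prime : Prime (suc p-1)) where

  open Congruence p-1

  1<p : 1 < p
  1<p = nonTrivial⇒n>1 p {{prime⇒nonTrivial p-prime}}

  p∤n! : ∀ {n} → n < p → p ∤ n !
  p∤n! {zero}  _   p∣1 = <⇒≢ 1<p (sym (∣1⇒≡1 p∣1))
  p∤n! {suc n} n<p p∣n! with euclidsLemma (suc n) (n !) p-prime p∣n!
  ... | inj₁ p∣1+n = <⇒≱ n<p (∣⇒≤ p∣1+n)
  ... | inj₂ p∣n!  = p∤n! (<-trans (n<1+n n) n<p) p∣n!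

  nCk*k!*[n∸k]!≡n! : ∀ {n k} → k ≤ n → (n C k) * (k ! * (n ∸ k) !) ≡ n !
  nCk*k!*[n∸k]!≡n! {n} {k} k≤n = trans
    (cong (_* (k ! * (n ∸ k) !)) (nCk≡n!/k![n-k]! k≤n))
    (m/n*n≡m {{k !* (n ∸ k) !≢0}} (k![n∸k]!∣n! k≤n))

  p∤nCk : ∀ {n k} → k ≤ n → n < p → p ∤ n C k
  p∤nCk k≤n n<p p∣nCk = p∤n! n<p
    (subst (p ∣_) (nCk*k!*[n∸k]!≡n! k≤n) (∣-trans p∣nCk (m∣m*n _)))

  p∣pCk : ∀ {k} → 0 < k → k < p → p ∣ p C k
  p∣pCk {k} 0<k k<p with euclidsLemma (p C k) (k ! * (p ∸ k) !) p-prime p∣p!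
    where p∣p! = subst (p ∣_) (sym (nCk*k!*[n∸k]!≡n! (<⇒≤ k<p))) (divides (p-1 !) (*-comm p (p-1 !)))
  ... | inj₁ p∣pCk = p∣pCk
  ... | inj₂ p∣k![p∸k]! with euclidsLemma (k !) ((p ∸ k) !) p-prime p∣k![p∸k]!
  ...   | inj₁ p∣k!     = ⊥-elim (p∤n! k<p p∣k!)
  ...   | inj₂ p∣[p∸k]! = ⊥-elim (p∤n! (∸-monoʳ-< 0<k (<⇒≤ k<p)) p∣[p∸k]!)

  pascal-≈ : ∀ n k {x y} → n C k ≈ x → n C suc k ≈ y → suc n C suc k ≈ x + y
  pascal-≈ n k e f = ≈-trans (≈-reflexive (sym (nCk+nC[k+1]≡[n+1]C[k+1] n k))) (+-cong e f)

  pascalʳ : ∀ a b d → a * (b C d) + a * (b C suc d) ≡ a * (suc b C suc d)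
  pascalʳ a b d = trans (sym (*-distribˡ-+ a (b C d) (b C suc d))) (cong (a *_) (nCk+nC[k+1]≡[n+1]C[k+1] b d))

  -- Pascal's rule lowers both indices by one, recursing on (a, b) lexicographically. When only the
  -- upper index borrows (b = 0 < d), the two terms recombine into a multiple of p C d, which p divides.
  lucas : ∀ a b c d → b < p → d < p → (b + a * p) C (d + c * p) ≈ (a C c) * (b C d)
  lucas zero zero zero zero _ _ = ≈-refl
  lucas zero zero zero (suc d) _ _ = ≈-refl
  lucas zero zero (suc c) d _ _ = ≈-reflexive (k>n⇒nCk≡0 (≤-trans (s≤s z≤n) (m≤n+m (suc c * p) d)))
  lucas a (suc b) zero zero _ _ = ≈-refl
  lucas a (suc b) c (suc d) b<p d<p =
    ≈-trans (pascal-≈ (b + a * p) (d + c * p) (lucas a b c d (<⇒≤ b<p) (<⇒≤ d<p)) (lucas a b c (suc d) (<⇒≤ b<p) d<p))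
            (≈-reflexive (pascalʳ (a C c) b d))
  lucas a (suc b) (suc c) zero b<p _ =
    ≈-trans (pascal-≈ (b + a * p) (p-1 + c * p) (lucas a b c p-1 (<⇒≤ b<p) ≤-refl) (lucas a b (suc c) 0 (<⇒≤ b<p) (s≤s z≤n)))
            (≈-reflexive (begin
              (a C c) * (b C p-1) + (a C suc c) * 1  ≡⟨ cong (λ x → (a C c) * x + (a C suc c) * 1) (k>n⇒nCk≡0 (≤-pred b<p)) ⟩
              (a C c) * 0 + (a C suc c) * 1          ≡⟨ cong (_+ (a C suc c) * 1) (*-zeroʳ (a C c)) ⟩
              (a C suc c) * 1                        ∎))
    where open ≡-Reasoning
  lucas (suc a) zero zero zero _ _ = ≈-refl
  lucas (suc a) zero c (suc d) _ d<p =
    ≈-trans (pascal-≈ (p-1 + a * p) (d + c * p) (lucas a p-1 c d ≤-refl (<⇒≤ d<p)) (lucas a p-1 c (suc d) ≤-refl d<p))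
            (≈-trans (≈-reflexive (pascalʳ (a C c) p-1 d))
            (≈-trans (*-zeroʳ-≈ (a C c) (∣⇒≈0 (p∣pCk (s≤s z≤n) d<p)))
                     (≈-reflexive (sym (*-zeroʳ (suc a C c))))))
  lucas (suc a) zero (suc c) zero _ _ =
    ≈-trans (pascal-≈ (p-1 + a * p) (p-1 + c * p) (lucas a p-1 c p-1 ≤-refl ≤-refl) (lucas a p-1 (suc c) 0 ≤-refl (s≤s z≤n)))
            (≈-reflexive (begin
              (a C c) * (p-1 C p-1) + (a C suc c) * 1  ≡⟨ cong (λ x → (a C c) * x + (a C suc c) * 1) (nCn≡1 p-1) ⟩
              (a C c) * 1 + (a C suc c) * 1            ≡⟨ *-distribʳ-+ 1 (a C c) (a C suc c) ⟨
              (a C c + a C suc c) * 1                  ≡⟨ cong (_* 1) (nCk+nC[k+1]≡[n+1]C[k+1] a c) ⟩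
              (suc a C suc c) * 1                      ∎))
    where open ≡-Reasoning

  lucas-divMod : ∀ n k → n C k ≈ (n / p C k / p) * (n % p C k % p)
  lucas-divMod n k =
    subst₂ (λ n′ k′ → n′ C k′ ≈ (n / p C k / p) * (n % p C k % p)) (sym (m≡m%n+[m/n]*n n p)) (sym (m≡m%n+[m/n]*n k p))
           (lucas (n / p) (n % p) (k / p) (k % p) (m%n<n n p) (m%n<n k p))

  1≉0 : 1 ≉0
  1≉0 (mod-≡ 1%p≡0) = 1≢0 (trans (sym (m<n⇒m%n≡m 1<p)) 1%p≡0)
    where
      1≢0 : 1 ≢ 0
      1≢0 ()

  *-≉0⇔ : ∀ x y → x * y ≉0 ⇔ (x ≉0 × y ≉0)
  *-≉0⇔ x y = mk⇔ (λ xy≉0 → (λ x≈0 → xy≉0 (*-zeroˡ-≈ y x≈0)) , (λ y≈0 → xy≉0 (*-zeroʳ-≈ x y≈0)))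
                  (λ (x≉0 , y≉0) xy≈0 → [ (λ p∣x → x≉0 (∣⇒≈0 p∣x)) , (λ p∣y → y≉0 (∣⇒≈0 p∣y)) ]′
                                          (euclidsLemma x y p-prime (≈0⇒∣ xy≈0)))

  ≈-≉0⇔ : ∀ {x y} → x ≈ y → x ≉0 ⇔ y ≉0
  ≈-≉0⇔ x≈y = mk⇔ (λ x≉0 y≈0 → x≉0 (≈-trans x≈y y≈0)) (λ y≉0 x≈0 → y≉0 (≈-trans (≈-sym x≈y) x≈0))

  small-C≉0⇔ : ∀ {b} d → b < p → b C d ≉0 ⇔ d ≤ b
  small-C≉0⇔ {b} d b<p = mk⇔ to (λ d≤b bCd≈0 → p∤nCk d≤b b<p (≈0⇒∣ bCd≈0))
    where
      to : b C d ≉0 → d ≤ b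
      to bCd≉0 with d ≤? b
      ... | yes d≤b = d≤b
      ... | no d≰b  = ⊥-elim (bCd≉0 (≈-reflexive (k>n⇒nCk≡0 (≰⇒> d≰b))))

  digit-zero : ∀ n → digit p 0 n ≡ n % p
  digit-zero n = cong (_% p) (n/1≡n n)

  digit-suc : ∀ e n → digit p (suc e) n ≡ digit p e (n / p)
  digit-suc e n = cong (_% p) (sym (m/n/o≡m/[n*o] n p (p ^ e) {{_}} {{m^n≢0 p e}} {{m^n≢0 p (suc e)}}))

  InG-divMod : ∀ n k → InG p n k ⇔ (InG p (n / p) (k / p) × k % p ≤ n % p)
  InG-divMod n k = mk⇔
    (λ k≼n → (λ e → subst₂ _≤_ (digit-suc e k) (digit-suc e n) (k≼n (suc e)))
           , subst₂ _≤_ (digit-zero k) (digit-zero n) (k≼n 0))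
    (λ where (k/p≼n/p , _)   (suc e) → subst₂ _≤_ (sym (digit-suc e k)) (sym (digit-suc e n)) (k/p≼n/p e)
             (_ , k%p≤n%p) zero    → subst₂ _≤_ (sym (digit-zero k)) (sym (digit-zero n)) k%p≤n%p)

  C≉0⇔InG-step : ∀ n k → (n / p C k / p ≉0 ⇔ InG p (n / p) (k / p)) → (n C k ≉0 ⇔ InG p n k)
  C≉0⇔InG-step n k ih =
    ⇔-trans (≈-≉0⇔ (lucas-divMod n k))
    (⇔-trans (*-≉0⇔ (n / p C k / p) (n % p C k % p))
    (⇔-trans (ih ×-⇔ small-C≉0⇔ (k % p) (m%n<n n p))
             (⇔-sym (InG-divMod n k))))

  divMod-descent : ∀ {s} n k → 0 < n + k → n + k ≤ suc s → n / p + k / p ≤ s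
  divMod-descent {s} n k 0<n+k n+k≤1+s = <⇒≤pred (<-≤-trans (descent n k 0<n+k) n+k≤1+s)
    where
      descent : ∀ n k → 0 < n + k → n / p + k / p < n + k
      descent (suc n) k _ = +-mono-<-≤ (m/n<m (suc n) p 1<p) (m/n≤m k p)
      descent zero (suc k) _ = subst (λ z → z + suc k / p < suc k) (sym (0/n≡0 p)) (m/n<m (suc k) p 1<p)

  C≉0⇔InG : ∀ n k → n C k ≉0 ⇔ InG p n k
  C≉0⇔InG n k = bounded (n + k) n k ≤-refl
    where
      bounded : ∀ s n k → n + k ≤ s → n C k ≉0 ⇔ InG p n k
      bounded _ zero zero _ = mk⇔ (λ _ _ → ≤-refl) (λ _ → 1≉0)
      bounded (suc s) n@(suc _) k n+k≤1+s =
        C≉0⇔InG-step n k (bounded s (n / p) (k / p) (divMod-descent n k (s≤s z≤n) n+k≤1+s))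
      bounded (suc s) zero k@(suc _) n+k≤1+s =
        C≉0⇔InG-step zero k (bounded s (0 / p) (k / p) (divMod-descent zero k (s≤s z≤n) n+k≤1+s))

  InG-zero : ∀ m → InG p m 0
  InG-zero m = Equivalence.to (C≉0⇔InG m 0) 1≉0

  InG⇒≤ : ∀ {m g} → InG p m g → g ≤ m
  InG⇒≤ {m} {g} g≼m with g ≤? m
  ... | yes g≤m = g≤m
  ... | no g≰m  = ⊥-elim (Equivalence.from (C≉0⇔InG m g) g≼m (≈-reflexive (k>n⇒nCk≡0 (≰⇒> g≰m))))

  InG-∸ : ∀ {m g} → InG p m g → InG p m (m ∸ g)
  InG-∸ {m} {g} g≼m = Equivalence.to (C≉0⇔InG m (m ∸ g))
    (subst _≉0 (nCk≡nC[n∸k] (InG⇒≤ g≼m)) (Equivalence.from (C≉0⇔InG m g) g≼m))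

-- Finite sums

sumBelow : ℕ → (ℕ → ℕ) → ℕ
sumBelow zero    h = 0
sumBelow (suc k) h = h 0 + sumBelow k (h ∘ suc)

sumBelow-cong : ∀ k {h h′ : ℕ → ℕ} → (∀ i → i < k → h i ≡ h′ i) → sumBelow k h ≡ sumBelow k h′
sumBelow-cong zero    _ = refl
sumBelow-cong (suc k) e = cong₂ _+_ (e 0 (s≤s z≤n)) (sumBelow-cong k (λ i i<k → e (suc i) (s≤s i<k)))

sumBelow-zero : ∀ k {h : ℕ → ℕ} → (∀ i → i < k → h i ≡ 0) → sumBelow k h ≡ 0
sumBelow-zero zero    _ = refl
sumBelow-zero (suc k) e = cong₂ _+_ (e 0 (s≤s z≤n)) (sumBelow-zero k (λ i i<k → e (suc i) (s≤s i<k)))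

sumBelow-+ : ∀ k (f g : ℕ → ℕ) → sumBelow k (λ i → f i + g i) ≡ sumBelow k f + sumBelow k g
sumBelow-+ zero    f g = refl
sumBelow-+ (suc k) f g = trans (cong (f 0 + g 0 +_) (sumBelow-+ k (f ∘ suc) (g ∘ suc)))
                               (interchange (f 0) (g 0) (sumBelow k (f ∘ suc)) (sumBelow k (g ∘ suc)))
  where
    interchange : ∀ a b c d → a + b + (c + d) ≡ a + c + (b + d)
    interchange = solve-∀

*-sumBelow : ∀ k c (f : ℕ → ℕ) → c * sumBelow k f ≡ sumBelow k (λ i → c * f i)
*-sumBelow zero    c f = *-zeroʳ c
*-sumBelow (suc k) c f = trans (*-distribˡ-+ c (f 0) _) (cong (c * f 0 +_) (*-sumBelow k c (f ∘ suc)))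

sumBelow-last : ∀ k (h : ℕ → ℕ) → sumBelow (suc k) h ≡ sumBelow k h + h k
sumBelow-last zero    h = +-comm (h 0) 0
sumBelow-last (suc k) h = trans (cong (h 0 +_) (sumBelow-last k (h ∘ suc))) (sym (+-assoc (h 0) _ _))

sumBelow-reverse : ∀ k (h : ℕ → ℕ) → sumBelow k h ≡ sumBelow k (λ i → h (k ∸ suc i))
sumBelow-reverse zero    h = refl
sumBelow-reverse (suc k) h = begin
  h 0 + sumBelow k (h ∘ suc)                            ≡⟨ cong (h 0 +_) (sumBelow-reverse k (h ∘ suc)) ⟩
  h 0 + sumBelow k (λ i → h (suc (k ∸ suc i)))          ≡⟨ +-comm (h 0) _ ⟩
  sumBelow k (λ i → h (suc (k ∸ suc i))) + h 0          ≡⟨ cong₂ _+_ (sumBelow-cong k (λ i i<k → cong h (sym (+-∸-assoc 1 i<k))))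
                                                                     (cong h (sym (n∸n≡0 k))) ⟩
  sumBelow k (λ i → h (k ∸ i)) + h (k ∸ k)              ≡⟨ sumBelow-last k (λ i → h (k ∸ i)) ⟨
  sumBelow (suc k) (λ i → h (k ∸ i))                    ∎
  where open ≡-Reasoning

ΣN≡sumBelow : ∀ n h → ΣN n h ≡ sumBelow (suc n) h
ΣN≡sumBelow n h = trans (cong (foldr _+_ 0) (map-applyUpTo (λ i → i) h (suc n))) (foldr-applyUpTo (suc n) h)
  where
    foldr-applyUpTo : ∀ k (f : ℕ → ℕ) → foldr _+_ 0 (applyUpTo f k) ≡ sumBelow k f
    foldr-applyUpTo zero    f = refl
    foldr-applyUpTo (suc k) f = cong (f 0 +_) (foldr-applyUpTo k (f ∘ suc))

δ : ℕ → ℕ → ℕ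
δ zero    zero    = 1
δ zero    (suc _) = 0
δ (suc _) zero    = 0
δ (suc a) (suc b) = δ a b

ind≤ : ℕ → ℕ → ℕ
ind≤ zero    _       = 1
ind≤ (suc a) zero    = 0
ind≤ (suc a) (suc b) = ind≤ a b

δ-refl : ∀ a → δ a a ≡ 1
δ-refl zero    = refl
δ-refl (suc a) = δ-refl a

δ-≢ : ∀ {a b} → a ≢ b → δ a b ≡ 0
δ-≢ {zero}  {zero}  a≢b = ⊥-elim (a≢b refl)
δ-≢ {zero}  {suc b} _   = refl
δ-≢ {suc a} {zero}  _   = refl
δ-≢ {suc a} {suc b} a≢b = δ-≢ (a≢b ∘ cong suc)

δ-sym : ∀ a b → δ a b ≡ δ b a
δ-sym zero    zero    = refl
δ-sym zero    (suc b) = refl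
δ-sym (suc a) zero    = refl
δ-sym (suc a) (suc b) = δ-sym a b

ind≤-yes : ∀ {a b} → a ≤ b → ind≤ a b ≡ 1
ind≤-yes {zero}          _         = refl
ind≤-yes {suc a} {suc b} (s≤s a≤b) = ind≤-yes a≤b

ind≤-no : ∀ {a b} → b < a → ind≤ a b ≡ 0
ind≤-no {suc a} {zero}  _         = refl
ind≤-no {suc a} {suc b} (s≤s b<a) = ind≤-no b<a

sumBelow-δ : ∀ k c (v : ℕ → ℕ) → sumBelow k (λ i → δ i c * v i) ≡ ind≤ (suc c) k * v c
sumBelow-δ zero    c       v = refl
sumBelow-δ (suc k) zero    v = trans (cong (v 0 + 0 +_) (sumBelow-zero k (λ _ _ → refl))) (+-identityʳ _)
sumBelow-δ (suc k) (suc c) v = sumBelow-δ k c (v ∘ suc)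

sumBox : ℕ → ℕ → (ℕ → ℕ → ℕ) → ℕ
sumBox i j F = sumBelow (suc i) (λ a → sumBelow (suc j) (F a))

sumBox-cong : ∀ i j {F F′ : ℕ → ℕ → ℕ} → (∀ a b → a ≤ i → b ≤ j → F a b ≡ F′ a b) → sumBox i j F ≡ sumBox i j F′
sumBox-cong i j e = sumBelow-cong (suc i) (λ a a<1+i → sumBelow-cong (suc j) (λ b b<1+j → e a b (≤-pred a<1+i) (≤-pred b<1+j)))

sumBox-zero : ∀ i j {F : ℕ → ℕ → ℕ} → (∀ a b → F a b ≡ 0) → sumBox i j F ≡ 0
sumBox-zero i j e = sumBelow-zero (suc i) (λ a _ → sumBelow-zero (suc j) (λ b _ → e a b))

sumBox-+ : ∀ i j (F G : ℕ → ℕ → ℕ) → sumBox i j (λ a b → F a b + G a b) ≡ sumBox i j F + sumBox i j G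
sumBox-+ i j F G = trans (sumBelow-cong (suc i) (λ a _ → sumBelow-+ (suc j) (F a) (G a)))
                         (sumBelow-+ (suc i) (λ a → sumBelow (suc j) (F a)) (λ a → sumBelow (suc j) (G a)))

*-sumBox : ∀ i j c (F : ℕ → ℕ → ℕ) → c * sumBox i j F ≡ sumBox i j (λ a b → c * F a b)
*-sumBox i j c F = trans (*-sumBelow (suc i) c (λ a → sumBelow (suc j) (F a))) (sumBelow-cong (suc i) (λ a _ → *-sumBelow (suc j) c (F a)))

sumBox-reverse : ∀ i j (F : ℕ → ℕ → ℕ) → sumBox i j F ≡ sumBox i j (λ a b → F (i ∸ a) (j ∸ b))
sumBox-reverse i j F = trans (sumBelow-reverse (suc i) (λ a → sumBelow (suc j) (F a)))
                             (sumBelow-cong (suc i) (λ a _ → sumBelow-reverse (suc j) (F (i ∸ a))))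

sumBox-δ : ∀ i j a b (H : ℕ → ℕ → ℕ) → sumBox i j (λ a′ b′ → δ a′ a * δ b′ b * H a′ b′) ≡ ind≤ a i * (ind≤ b j * H a b)
sumBox-δ i j a b H = begin
  sumBox i j (λ a′ b′ → δ a′ a * δ b′ b * H a′ b′)
    ≡⟨ sumBelow-cong (suc i) (λ a′ _ → trans (sumBelow-cong (suc j) (λ b′ _ → *-assoc (δ a′ a) (δ b′ b) (H a′ b′)))
                                                (sym (*-sumBelow (suc j) (δ a′ a) (λ b′ → δ b′ b * H a′ b′)))) ⟩
  sumBelow (suc i) (λ a′ → δ a′ a * sumBelow (suc j) (λ b′ → δ b′ b * H a′ b′))
    ≡⟨ sumBelow-cong (suc i) (λ a′ _ → cong (δ a′ a *_) (sumBelow-δ (suc j) b (H a′))) ⟩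
  sumBelow (suc i) (λ a′ → δ a′ a * (ind≤ b j * H a′ b))
    ≡⟨ sumBelow-δ (suc i) a (λ a′ → ind≤ b j * H a′ b) ⟩
  ind≤ a i * (ind≤ b j * H a b) ∎
  where open ≡-Reasoning

-- Coefficient identities for polynomials over ℕ

infix 4 _≐_
_≐_ : Pol → Pol → Set
f ≐ g = ∀ i j → f i j ≡ g i j

*P-coeff : ∀ f g i j → (f *P g) i j ≡ sumBox i j (λ a b → f a b * g (i ∸ a) (j ∸ b))
*P-coeff f g i j = trans (ΣN≡sumBelow i _) (sumBelow-cong (suc i) (λ a _ → ΣN≡sumBelow j (λ b → f a b * g (i ∸ a) (j ∸ b))))

*P-congʳ : ∀ f {g g′} → g ≐ g′ → f *P g ≐ f *P g′
*P-congʳ f {g} {g′} g≐g′ i j = begin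
  (f *P g) i j                                       ≡⟨ *P-coeff f g i j ⟩
  sumBox i j (λ a b → f a b * g (i ∸ a) (j ∸ b))     ≡⟨ sumBox-cong i j (λ a b _ _ → cong (f a b *_) (g≐g′ (i ∸ a) (j ∸ b))) ⟩
  sumBox i j (λ a b → f a b * g′ (i ∸ a) (j ∸ b))    ≡⟨ *P-coeff f g′ i j ⟨
  (f *P g′) i j                                      ∎
  where open ≡-Reasoning

*P-comm : ∀ f g → f *P g ≐ g *P f
*P-comm f g i j = begin
  (f *P g) i j                                                   ≡⟨ *P-coeff f g i j ⟩
  sumBox i j (λ a b → f a b * g (i ∸ a) (j ∸ b))                 ≡⟨ sumBox-reverse i j (λ a b → f a b * g (i ∸ a) (j ∸ b)) ⟩
  sumBox i j (λ a b → f (i ∸ a) (j ∸ b) * g (i ∸ (i ∸ a)) (j ∸ (j ∸ b)))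
    ≡⟨ sumBox-cong i j (λ a b a≤i b≤j → trans (cong₂ (λ a′ b′ → f (i ∸ a) (j ∸ b) * g a′ b′) (m∸[m∸n]≡n a≤i) (m∸[m∸n]≡n b≤j))
                                              (*-comm (f (i ∸ a) (j ∸ b)) (g a b))) ⟩
  sumBox i j (λ a b → g a b * f (i ∸ a) (j ∸ b))                 ≡⟨ *P-coeff g f i j ⟨
  (g *P f) i j                                                   ∎
  where open ≡-Reasoning

*P-distribʳ-+P : ∀ f g h → (f +P g) *P h ≐ (f *P h) +P (g *P h)
*P-distribʳ-+P f g h i j = begin
  ((f +P g) *P h) i j                                ≡⟨ *P-coeff (f +P g) h i j ⟩
  sumBox i j (λ a b → (f a b + g a b) * h′ a b)      ≡⟨ sumBox-cong i j (λ a b _ _ → *-distribʳ-+ (h′ a b) (f a b) (g a b)) ⟩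
  sumBox i j (λ a b → f a b * h′ a b + g a b * h′ a b)
                                                     ≡⟨ sumBox-+ i j (λ a b → f a b * h′ a b) (λ a b → g a b * h′ a b) ⟩
  sumBox i j (λ a b → f a b * h′ a b) + sumBox i j (λ a b → g a b * h′ a b)
                                                     ≡⟨ cong₂ _+_ (*P-coeff f h i j) (*P-coeff g h i j) ⟨
  (f *P h) i j + (g *P h) i j                        ∎
  where
    open ≡-Reasoning
    h′ : ℕ → ℕ → ℕ
    h′ a b = h (i ∸ a) (j ∸ b)

*P-distribˡ-+P : ∀ f g h → f *P (g +P h) ≐ (f *P g) +P (f *P h)
*P-distribˡ-+P f g h i j = begin
  (f *P (g +P h)) i j                  ≡⟨ *P-comm f (g +P h) i j ⟩
  ((g +P h) *P f) i j                  ≡⟨ *P-distribʳ-+P g h f i j ⟩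
  (g *P f) i j + (h *P f) i j          ≡⟨ cong₂ _+_ (*P-comm g f i j) (*P-comm h f i j) ⟩
  (f *P g) i j + (f *P h) i j          ∎
  where open ≡-Reasoning

scale-*P : ∀ c f g → scale c f *P g ≐ scale c (f *P g)
scale-*P c f g i j = begin
  (scale c f *P g) i j                                 ≡⟨ *P-coeff (scale c f) g i j ⟩
  sumBox i j (λ a b → c * f a b * g (i ∸ a) (j ∸ b))   ≡⟨ sumBox-cong i j (λ a b _ _ → *-assoc c (f a b) (g (i ∸ a) (j ∸ b))) ⟩
  sumBox i j (λ a b → c * (f a b * g (i ∸ a) (j ∸ b))) ≡⟨ *-sumBox i j c (λ a b → f a b * g (i ∸ a) (j ∸ b)) ⟨
  c * sumBox i j (λ a b → f a b * g (i ∸ a) (j ∸ b))   ≡⟨ cong (c *_) (*P-coeff f g i j) ⟨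
  c * (f *P g) i j                                     ∎
  where open ≡-Reasoning

monomial : ℕ → ℕ → Pol
monomial a b i j = δ i a * δ j b

-- x^a y^b · h; the factors ind≤ discard the junk values of the truncated subtractions.
shift : ℕ → ℕ → Pol → Pol
shift a b h i j = ind≤ a i * (ind≤ b j * h (i ∸ a) (j ∸ b))

monomial-*P : ∀ {a b F} h → F ≐ monomial a b → F *P h ≐ shift a b h
monomial-*P {a} {b} {F} h F≐x^ay^b i j = begin
  (F *P h) i j                                                  ≡⟨ *P-coeff F h i j ⟩
  sumBox i j (λ a′ b′ → F a′ b′ * h (i ∸ a′) (j ∸ b′))          ≡⟨ sumBox-cong i j (λ a′ b′ _ _ → cong (_* h (i ∸ a′) (j ∸ b′)) (F≐x^ay^b a′ b′)) ⟩
  sumBox i j (λ a′ b′ → δ a′ a * δ b′ b * h (i ∸ a′) (j ∸ b′))  ≡⟨ sumBox-δ i j a b (λ a′ b′ → h (i ∸ a′) (j ∸ b′)) ⟩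
  shift a b h i j                                               ∎
  where open ≡-Reasoning

1*1*x≡x : ∀ x → 1 * (1 * x) ≡ x
1*1*x≡x x = trans (*-identityˡ _) (*-identityˡ x)

mono≐monomial : ∀ a b → mono a b ≐ monomial a b
mono≐monomial a b i j with i ≟ a | j ≟ b
... | yes refl | yes refl = sym (cong₂ _*_ (δ-refl i) (δ-refl j))
... | yes refl | no j≢b   = sym (trans (cong (δ i i *_) (δ-≢ j≢b)) (*-zeroʳ (δ i i)))
... | no i≢a   | _        = sym (cong (_* δ j b) (δ-≢ i≢a))

X^P≐monomial : ∀ n → X ^P n ≐ monomial n 0
X^P≐monomial zero    i       j = mono≐monomial 0 0 i j
X^P≐monomial (suc n) i       j = trans (monomial-*P (X ^P n) (mono≐monomial 1 0) i j) (shifted i)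
  where
    shifted : ∀ i → shift 1 0 (X ^P n) i j ≡ monomial (suc n) 0 i j
    shifted zero    = refl
    shifted (suc i) = trans (1*1*x≡x _) (X^P≐monomial n i j)

Y^P≐monomial : ∀ n → Y ^P n ≐ monomial 0 n
Y^P≐monomial zero    i j = mono≐monomial 0 0 i j
Y^P≐monomial (suc n) i j = trans (monomial-*P (Y ^P n) (mono≐monomial 0 1) i j) (shifted j)
  where
    shifted : ∀ j → shift 0 1 (Y ^P n) i j ≡ monomial 0 (suc n) i j
    shifted zero    = trans (*-identityˡ _) (sym (*-zeroʳ (δ i 0)))
    shifted (suc j) = trans (1*1*x≡x _) (Y^P≐monomial n i j)

X^P*Y^P≐monomial : ∀ a b → (X ^P a) *P (Y ^P b) ≐ monomial a b
X^P*Y^P≐monomial a b i j = begin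
  ((X ^P a) *P (Y ^P b)) i j               ≡⟨ monomial-*P (Y ^P b) (X^P≐monomial a) i j ⟩
  ind≤ a i * (1 * (Y ^P b) (i ∸ a) j)      ≡⟨ cong (ind≤ a i *_) (trans (*-identityˡ _) (Y^P≐monomial b (i ∸ a) j)) ⟩
  ind≤ a i * (δ (i ∸ a) 0 * δ j b)         ≡⟨ *-assoc (ind≤ a i) _ _ ⟨
  ind≤ a i * δ (i ∸ a) 0 * δ j b           ≡⟨ cong (_* δ j b) (ind≤*δ∸ a i) ⟩
  δ i a * δ j b                            ∎
  where
    open ≡-Reasoning
    ind≤*δ∸ : ∀ a i → ind≤ a i * δ (i ∸ a) 0 ≡ δ i a
    ind≤*δ∸ zero    i       = +-identityʳ (δ i 0)
    ind≤*δ∸ (suc a) zero    = refl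
    ind≤*δ∸ (suc a) (suc i) = ind≤*δ∸ a i

binom : ℕ → Pol
binom m i j = δ (i + j) m * (m C i)

binom-vanishes : ∀ m i j → m < i → binom m i j ≡ 0
binom-vanishes m i j m<i = trans (cong (δ (i + j) m *_) (k>n⇒nCk≡0 m<i)) (*-zeroʳ (δ (i + j) m))

binom-degree : ∀ m i j → i + j ≢ m → binom m i j ≡ 0
binom-degree m i j i+j≢m = cong (_* (m C i)) (δ-≢ i+j≢m)

binom-suc : ∀ m → shift 1 0 (binom m) +P shift 0 1 (binom m) ≐ binom (suc m)
binom-suc m zero    zero    = refl
binom-suc m zero    (suc j) = 1*1*x≡x _
binom-suc m (suc i) zero    = begin
  1 * (1 * binom m i 0) + 1 * 0               ≡⟨ cong₂ _+_ (1*1*x≡x (binom m i 0)) (*-zeroʳ 1) ⟩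
  binom m i 0 + 0                             ≡⟨ +-identityʳ _ ⟩
  δ (i + 0) m * (m C i)                       ≡⟨ cong (λ k → δ k m * (m C i)) (+-identityʳ i) ⟩
  δ i m * (m C i)                             ≡⟨ diagonal i m ⟩
  δ i m * (suc m C suc i)                     ≡⟨ cong (λ k → δ k m * (suc m C suc i)) (+-identityʳ i) ⟨
  binom (suc m) (suc i) 0                     ∎
  where
    open ≡-Reasoning
    diagonal : ∀ i m → δ i m * (m C i) ≡ δ i m * (suc m C suc i)
    diagonal i m with i ≟ m
    ... | yes refl = cong (δ i i *_) (trans (nCn≡1 i) (sym (nCn≡1 (suc i))))
    ... | no i≢m   = trans (cong (_* (m C i)) (δ-≢ i≢m)) (sym (cong (_* (suc m C suc i)) (δ-≢ i≢m)))
binom-suc m (suc i) (suc j) = begin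
  1 * (1 * binom m i (suc j)) + 1 * (1 * binom m (suc i) j)  ≡⟨ cong₂ _+_ (1*1*x≡x (binom m i (suc j))) (1*1*x≡x (binom m (suc i) j)) ⟩
  δ (i + suc j) m * (m C i) + δ (suc i + j) m * (m C suc i)  ≡⟨ cong (λ k → δ k m * (m C i) + δ (suc i + j) m * (m C suc i)) (+-suc i j) ⟩
  δ (suc i + j) m * (m C i) + δ (suc i + j) m * (m C suc i)  ≡⟨ *-distribˡ-+ (δ (suc i + j) m) (m C i) (m C suc i) ⟨
  δ (suc i + j) m * (m C i + m C suc i)                      ≡⟨ cong (δ (suc i + j) m *_) (nCk+nC[k+1]≡[n+1]C[k+1] m i) ⟩
  δ (suc i + j) m * (suc m C suc i)                          ≡⟨ cong (λ k → δ k m * (suc m C suc i)) (+-suc i j) ⟨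
  binom (suc m) (suc i) (suc j)                              ∎
  where open ≡-Reasoning

XY^P≐binom : ∀ m → XY ^P m ≐ binom m
XY^P≐binom zero    zero    zero    = refl
XY^P≐binom zero    zero    (suc j) = refl
XY^P≐binom zero    (suc i) j       = refl
XY^P≐binom (suc m) i       j       = begin
  (XY *P (XY ^P m)) i j                             ≡⟨ *P-distribʳ-+P X Y (XY ^P m) i j ⟩
  (X *P (XY ^P m)) i j + (Y *P (XY ^P m)) i j       ≡⟨ cong₂ _+_ (monomial-*P (XY ^P m) (mono≐monomial 1 0) i j)
                                                                 (monomial-*P (XY ^P m) (mono≐monomial 0 1) i j) ⟩
  shift 1 0 (XY ^P m) i j + shift 0 1 (XY ^P m) i j ≡⟨ cong₂ _+_ (cong (λ c → ind≤ 1 i * (1 * c)) (XY^P≐binom m (i ∸ 1) j))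
                                                                 (cong (λ c → 1 * (ind≤ 1 j * c)) (XY^P≐binom m i (j ∸ 1))) ⟩
  shift 1 0 (binom m) i j + shift 0 1 (binom m) i j ≡⟨ binom-suc m i j ⟩
  binom (suc m) i j                                 ∎
  where open ≡-Reasoning

term≐ : ∀ m k → term m k ≐ λ i j → δ i k * binom m i j
term≐ m k i j = trans (cong ((m C k) *_) (X^P*Y^P≐monomial k (m ∸ k) i j)) (diagonal i k)
  where
    δ-complement : ∀ i m j → i ≤ m → δ j (m ∸ i) ≡ δ (i + j) m
    δ-complement zero    m       j _         = refl
    δ-complement (suc i) (suc m) j (s≤s i≤m) = δ-complement i m j i≤m
    diagonal : ∀ i k → (m C k) * (δ i k * δ j (m ∸ k)) ≡ δ i k * binom m i j
    diagonal i k with i ≟ k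
    ... | no i≢k = trans (cong (λ d → (m C k) * (d * δ j (m ∸ k))) (δ-≢ i≢k))
                         (trans (*-zeroʳ (m C k)) (sym (cong (_* binom m i j) (δ-≢ i≢k))))
    ... | yes refl with i ≤? m
    ...   | no i≰m = trans (cong (_* (δ i i * δ j (m ∸ i))) (k>n⇒nCk≡0 (≰⇒> i≰m)))
                           (sym (trans (cong (δ i i *_) (binom-vanishes m i j (≰⇒> i≰m))) (*-zeroʳ (δ i i))))
    ...   | yes i≤m = begin
      (m C i) * (δ i i * δ j (m ∸ i))  ≡⟨ cong (λ d → (m C i) * (d * δ j (m ∸ i))) (δ-refl i) ⟩
      (m C i) * (1 * δ j (m ∸ i))      ≡⟨ cong ((m C i) *_) (trans (*-identityˡ _) (δ-complement i m j i≤m)) ⟩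
      (m C i) * δ (i + j) m            ≡⟨ *-comm (m C i) _ ⟩
      binom m i j                      ≡⟨ *-identityˡ _ ⟨
      1 * binom m i j                  ≡⟨ cong (_* binom m i j) (δ-refl i) ⟨
      δ i i * binom m i j              ∎
      where open ≡-Reasoning

inRange : ℕ → ℕ → ℕ → ℕ
inRange lo n i = ind≤ lo i * ind≤ (suc (i ∸ lo)) n

sumBelow-δ-offset : ∀ n lo i v → sumBelow n (λ k → δ i (lo + k) * v) ≡ inRange lo n i * v
sumBelow-δ-offset n zero i v = begin
  sumBelow n (λ k → δ i k * v)   ≡⟨ sumBelow-cong n (λ k _ → cong (_* v) (δ-sym i k)) ⟩
  sumBelow n (λ k → δ k i * v)   ≡⟨ sumBelow-δ n i (λ _ → v) ⟩
  ind≤ (suc i) n * v             ≡⟨ cong (_* v) (+-identityʳ (ind≤ (suc i) n)) ⟨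
  inRange zero n i * v           ∎
  where open ≡-Reasoning
sumBelow-δ-offset n (suc lo) zero    v = sumBelow-zero n (λ _ _ → refl)
sumBelow-δ-offset n (suc lo) (suc i) v = sumBelow-δ-offset n lo i v

sumP-applyUpTo : ∀ n (H : ℕ → Pol) → sumP (applyUpTo H n) ≐ λ i j → sumBelow n (λ k → H k i j)
sumP-applyUpTo zero    H i j = refl
sumP-applyUpTo (suc n) H i j = cong (H 0 i j +_) (sumP-applyUpTo n (H ∘ suc) i j)

sum-of-terms : ∀ m lo hi → sumP (map (term m) (rangeLt lo hi)) ≐ λ i j → inRange lo (hi ∸ lo) i * binom m i j
sum-of-terms m lo hi i j = begin
  sumP (map (term m) (map (lo +_) (upTo n))) i j    ≡⟨ cong (λ ks → sumP (map (term m) ks) i j) (map-applyUpTo (λ k → k) (lo +_) n) ⟩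
  sumP (map (term m) (applyUpTo (lo +_) n)) i j     ≡⟨ cong (λ ts → sumP ts i j) (map-applyUpTo (lo +_) (term m) n) ⟩
  sumP (applyUpTo (term m ∘ (lo +_)) n) i j         ≡⟨ sumP-applyUpTo n (term m ∘ (lo +_)) i j ⟩
  sumBelow n (λ k → term m (lo + k) i j)            ≡⟨ sumBelow-cong n (λ k _ → term≐ m (lo + k) i j) ⟩
  sumBelow n (λ k → δ i (lo + k) * binom m i j)     ≡⟨ sumBelow-δ-offset n lo i (binom m i j) ⟩
  inRange lo n i * binom m i j                      ∎
  where
    open ≡-Reasoning
    n = hi ∸ lo

ψˣ ψʸ : ℕ → ℕ → Pol
ψˣ m μ₁ = proj₁ (ψ m μ₁)
ψʸ m μ₁ = proj₂ (ψ m μ₁)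

ψˣ-below : ∀ m μ₁ i j → i < μ₁ → ψˣ m μ₁ i j ≡ 0
ψˣ-below m μ₁ i j i<μ₁ = trans (sum-of-terms m μ₁ (suc m) i j)
  (cong (λ c → c * ind≤ (suc (i ∸ μ₁)) (suc m ∸ μ₁) * binom m i j) (ind≤-no i<μ₁))

ψˣ-above : ∀ m μ₁ i j → μ₁ ≤ i → ψˣ m μ₁ i j ≡ binom m i j
ψˣ-above m μ₁ i j μ₁≤i with i ≤? m
... | no i≰m  = trans (sum-of-terms m μ₁ (suc m) i j)
                      (trans (cong (inRange μ₁ (suc m ∸ μ₁) i *_) (binom-vanishes m i j (≰⇒> i≰m)))
                             (trans (*-zeroʳ (inRange μ₁ (suc m ∸ μ₁) i)) (sym (binom-vanishes m i j (≰⇒> i≰m)))))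
... | yes i≤m = trans (sum-of-terms m μ₁ (suc m) i j) (trans (cong (_* binom m i j) in-range) (*-identityˡ _))
  where
    in-range : inRange μ₁ (suc m ∸ μ₁) i ≡ 1
    in-range = cong₂ _*_ (ind≤-yes μ₁≤i)
      (ind≤-yes (subst (suc (i ∸ μ₁) ≤_) (sym (+-∸-assoc 1 (≤-trans μ₁≤i i≤m))) (s≤s (∸-monoˡ-≤ μ₁ i≤m))))

ψʸ-below : ∀ m μ₁ i j → i < μ₁ → ψʸ m μ₁ i j ≡ binom m i j
ψʸ-below m μ₁ i j i<μ₁ = trans (sum-of-terms m 0 μ₁ i j)
  (trans (cong (λ c → 1 * c * binom m i j) (ind≤-yes i<μ₁)) (*-identityˡ _))

ψʸ-above : ∀ m μ₁ i j → μ₁ ≤ i → ψʸ m μ₁ i j ≡ 0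
ψʸ-above m μ₁ i j μ₁≤i = trans (sum-of-terms m 0 μ₁ i j)
  (cong (λ c → 1 * c * binom m i j) (ind≤-no (s≤s μ₁≤i)))

ψ-sum : ∀ m μ₁ → ψˣ m μ₁ +P ψʸ m μ₁ ≐ binom m
ψ-sum m μ₁ i j with i <? μ₁
... | yes i<μ₁ = cong₂ _+_ (ψˣ-below m μ₁ i j i<μ₁) (ψʸ-below m μ₁ i j i<μ₁)
... | no i≮μ₁  = trans (cong₂ _+_ (ψˣ-above m μ₁ i j (≮⇒≥ i≮μ₁)) (ψʸ-above m μ₁ i j (≮⇒≥ i≮μ₁)))
                       (+-identityʳ _)

unshift : ℕ → ℕ → Pol → Pol
unshift a b f i j = f (i + a) (j + b)

shift-inside : ∀ {a b i j} h → a ≤ i → b ≤ j → shift a b h i j ≡ h (i ∸ a) (j ∸ b)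
shift-inside {a} {b} {i} {j} h a≤i b≤j =
  trans (cong₂ (λ x y → x * (y * h (i ∸ a) (j ∸ b))) (ind≤-yes a≤i) (ind≤-yes b≤j)) (1*1*x≡x _)

shift-outside : ∀ {a b i j} h → i < a ⊎ j < b → shift a b h i j ≡ 0
shift-outside {a} {b} {i} {j} h (inj₁ i<a) = cong (_* (ind≤ b j * h (i ∸ a) (j ∸ b))) (ind≤-no i<a)
shift-outside {a} {b} {i} {j} h (inj₂ j<b) =
  trans (cong (λ y → ind≤ a i * (y * h (i ∸ a) (j ∸ b))) (ind≤-no j<b)) (*-zeroʳ (ind≤ a i))

unshift-shift : ∀ a b h → unshift a b (shift a b h) ≐ h
unshift-shift a b h i j = trans (shift-inside h (m≤n+m a i) (m≤n+m b j)) (cong₂ h (m+n∸n≡m i a) (m+n∸n≡m j b))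

shift-unshift : ∀ a b f {i j} → a ≤ i → b ≤ j → shift a b (unshift a b f) i j ≡ f i j
shift-unshift a b f a≤i b≤j = trans (shift-inside (unshift a b f) a≤i b≤j) (cong₂ f (m∸n+n≡m a≤i) (m∸n+n≡m b≤j))

-- In the row u = i of this coefficient only the term y^m of (x+y)^m contributes, leaving a i j.
binom-top-coeff : ∀ m a i j →
  (a *P binom m) i (j + m) ≡ sumBelow i (λ u → sumBelow (suc (j + m)) (λ v → a u v * binom m (i ∸ u) (j + m ∸ v))) + a i j
binom-top-coeff m a i j = begin
  (a *P binom m) i (j + m)                   ≡⟨ *P-coeff a (binom m) i (j + m) ⟩
  sumBelow (suc i) row                       ≡⟨ sumBelow-last i row ⟩
  sumBelow i row + row i                     ≡⟨ cong (sumBelow i row +_) top-row ⟩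
  sumBelow i row + a i j                     ∎
  where
    open ≡-Reasoning
    row : ℕ → ℕ
    row u = sumBelow (suc (j + m)) (λ v → a u v * binom m (i ∸ u) (j + m ∸ v))
    δ-top : ∀ j k v → v ≤ j + k → δ (j + k ∸ v) k ≡ δ v j
    δ-top j       k zero    _         = trans (δ-shift j k) (δ-sym j 0)
      where
        δ-shift : ∀ j k → δ (j + k) k ≡ δ j 0
        δ-shift j zero    = cong (λ x → δ x 0) (+-identityʳ j)
        δ-shift j (suc k) = trans (cong (λ x → δ x (suc k)) (+-suc j k)) (δ-shift j k)
    δ-top zero    k (suc v) v<k       = δ-≢ (<⇒≢ (∸-monoʳ-< {k} {suc v} {0} (s≤s z≤n) v<k))
    δ-top (suc j) k (suc v) (s≤s v≤j+k) = δ-top j k v v≤j+k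
    top-row : row i ≡ a i j
    top-row = begin
      sumBelow (suc (j + m)) (λ v → a i v * binom m (i ∸ i) (j + m ∸ v))
        ≡⟨ sumBelow-cong (suc (j + m)) (λ v v≤j+m → begin
             a i v * binom m (i ∸ i) (j + m ∸ v)   ≡⟨ cong (λ x → a i v * binom m x (j + m ∸ v)) (n∸n≡0 i) ⟩
             a i v * (δ (j + m ∸ v) m * 1)         ≡⟨ cong (λ x → a i v * x) (*-identityʳ _) ⟩
             a i v * δ (j + m ∸ v) m               ≡⟨ cong (a i v *_) (δ-top j m v (≤-pred v≤j+m)) ⟩
             a i v * δ v j                         ≡⟨ *-comm (a i v) _ ⟩
             δ v j * a i v                         ∎) ⟩
      sumBelow (suc (j + m)) (λ v → δ v j * a i v)     ≡⟨ sumBelow-δ (suc (j + m)) j (a i) ⟩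
      ind≤ j (j + m) * a i j                            ≡⟨ cong (_* a i j) (ind≤-yes (m≤m+n j m)) ⟩
      1 * a i j                                         ≡⟨ *-identityˡ _ ⟩
      a i j                                             ∎

*P-zeroʳ : ∀ f → f *P 0P ≐ 0P
*P-zeroʳ f i j = trans (*P-coeff f 0P i j) (sumBox-zero i j (λ a b → *-zeroʳ (f a b)))

*P-one : ∀ f → f *P mono 0 0 ≐ f
*P-one f i j = trans (*P-comm f (mono 0 0) i j) (trans (monomial-*P f (mono≐monomial 0 0) i j) (1*1*x≡x (f i j)))

monomial-outside : ∀ {a b i j} → i < a ⊎ j < b → monomial a b i j ≡ 0
monomial-outside {a} {b} {i} {j} (inj₁ i<a) = cong (_* δ j b) (δ-≢ (<⇒≢ i<a))
monomial-outside {a} {b} {i} {j} (inj₂ j<b) = trans (cong (δ i a *_) (δ-≢ (<⇒≢ j<b))) (*-zeroʳ (δ i a))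

module PolynomialsModulo (p-1 : ℕ) where

  open Congruence p-1

  infix 4 _≈P_
  _≈P_ : Pol → Pol → Set
  f ≈P g = ∀ i j → f i j ≈ g i j

  ≈P⇒≈[p] : ∀ {f g} → f ≈P g → f ≈[ p ] g
  ≈P⇒≈[p] f≈g i j = ≈⇒≡[p] (f≈g i j)

  sumBelow-≈0 : ∀ k {h : ℕ → ℕ} → (∀ i → i < k → h i ≈ 0) → sumBelow k h ≈ 0
  sumBelow-≈0 zero    _ = ≈-refl
  sumBelow-≈0 (suc k) h≈0 = +-cong (h≈0 0 (s≤s z≤n)) (sumBelow-≈0 k (λ i i<k → h≈0 (suc i) (s≤s i<k)))

  sumBox-≈0 : ∀ i j {F : ℕ → ℕ → ℕ} → (∀ a b → a ≤ i → b ≤ j → F a b ≈ 0) → sumBox i j F ≈ 0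
  sumBox-≈0 i j F≈0 = sumBelow-≈0 (suc i) (λ a a<1+i → sumBelow-≈0 (suc j) (λ b b<1+j → F≈0 a b (≤-pred a<1+i) (≤-pred b<1+j)))

  sumBox-cong-≈ : ∀ i j {F F′ : ℕ → ℕ → ℕ} → (∀ a b → F a b ≈ F′ a b) → sumBox i j F ≈ sumBox i j F′
  sumBox-cong-≈ i j F≈F′ = cong-below (suc i) (λ a → cong-below (suc j) (F≈F′ a))
    where
      cong-below : ∀ k {h h′ : ℕ → ℕ} → (∀ i → h i ≈ h′ i) → sumBelow k h ≈ sumBelow k h′
      cong-below zero    _    = ≈-refl
      cong-below (suc k) h≈h′ = +-cong (h≈h′ 0) (cong-below k (h≈h′ ∘ suc))

  *P-congˡ-≈ : ∀ {f f′} g → f ≈P f′ → f *P g ≈P f′ *P g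
  *P-congˡ-≈ {f} {f′} g f≈f′ i j = begin
    (f *P g) i j                                     ≡⟨ *P-coeff f g i j ⟩
    sumBox i j (λ a b → f a b * g (i ∸ a) (j ∸ b))   ≈⟨ sumBox-cong-≈ i j (λ a b → *-cong (f≈f′ a b) (≈-refl {g (i ∸ a) (j ∸ b)})) ⟩
    sumBox i j (λ a b → f′ a b * g (i ∸ a) (j ∸ b))  ≡⟨ *P-coeff f′ g i j ⟨
    (f′ *P g) i j                                    ∎
    where open ≈-Reasoning

  *P-congʳ-≈ : ∀ f {g g′} → g ≈P g′ → f *P g ≈P f *P g′
  *P-congʳ-≈ f {g} {g′} g≈g′ i j = begin
    (f *P g) i j   ≡⟨ *P-comm f g i j ⟩
    (g *P f) i j   ≈⟨ *P-congˡ-≈ f g≈g′ i j ⟩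
    (g′ *P f) i j  ≡⟨ *P-comm g′ f i j ⟩
    (f *P g′) i j  ∎
    where open ≈-Reasoning

  *P-vanishesˣ : ∀ c {G} μ → (∀ k l → k < μ → G k l ≈ 0) → ∀ i j → i < μ → (c *P G) i j ≈ 0
  *P-vanishesˣ c {G} μ G≈0 i j i<μ = ≈-trans (≈-reflexive (*P-coeff c G i j))
    (sumBox-≈0 i j (λ a b _ _ → *-zeroʳ-≈ (c a b) (G≈0 (i ∸ a) (j ∸ b) (≤-<-trans (m∸n≤m i a) i<μ))))

  *P-vanishesʸ : ∀ c {G} μ → (∀ k l → l < μ → G k l ≈ 0) → ∀ i j → j < μ → (c *P G) i j ≈ 0
  *P-vanishesʸ c {G} μ G≈0 i j j<μ = ≈-trans (≈-reflexive (*P-coeff c G i j))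
    (sumBox-≈0 i j (λ a b _ _ → *-zeroʳ-≈ (c a b) (G≈0 (i ∸ a) (j ∸ b) (≤-<-trans (m∸n≤m j b) j<μ))))

  isPoly-0P : IsPoly p 0P
  isPoly-0P = 0 , λ _ _ _ → ≈⇒≡[p] ≈-refl

  isPoly-monomial : ∀ {a b F} → F ≐ monomial a b → IsPoly p F
  isPoly-monomial {a} {b} {F} F≐x^ay^b = a + b , λ i j a+b<i+j → ≈⇒≡[p] (≈-reflexive (trans (F≐x^ay^b i j) (off-corner i j a+b<i+j)))
    where
      off-corner : ∀ i j → a + b < i + j → δ i a * δ j b ≡ 0
      off-corner i j a+b<i+j with i ≟ a | j ≟ b
      ... | yes refl | yes refl = ⊥-elim (<-irrefl refl a+b<i+j)
      ... | yes refl | no j≢b   = trans (cong (δ i i *_) (δ-≢ j≢b)) (*-zeroʳ (δ i i))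
      ... | no i≢a   | _        = cong (_* δ j b) (δ-≢ i≢a)

  isPoly-ψˣ : ∀ m μ₁ → IsPoly p (ψˣ m μ₁)
  isPoly-ψˣ m μ₁ = m , λ i j m<i+j → ≈⇒≡[p] (≈-reflexive (trans (sum-of-terms m μ₁ (suc m) i j)
    (trans (cong (inRange μ₁ (suc m ∸ μ₁) i *_) (binom-degree m i j (≢-sym (<⇒≢ m<i+j)))) (*-zeroʳ (inRange μ₁ (suc m ∸ μ₁) i)))))

  isPoly-ψʸ : ∀ m μ₁ → IsPoly p (ψʸ m μ₁)
  isPoly-ψʸ m μ₁ = m , λ i j m<i+j → ≈⇒≡[p] (≈-reflexive (trans (sum-of-terms m 0 μ₁ i j)
    (trans (cong (inRange 0 μ₁ i *_) (binom-degree m i j (≢-sym (<⇒≢ m<i+j)))) (*-zeroʳ (inRange 0 μ₁ i)))))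

  isPoly-+P : ∀ {f g} → IsPoly p f → IsPoly p g → IsPoly p (f +P g)
  isPoly-+P (d , f≈0) (e , g≈0) = d + e , λ i j d+e<i+j →
    ≈⇒≡[p] (+-cong (≡[p]⇒≈ (f≈0 i j (≤-<-trans (m≤m+n d e) d+e<i+j)))
                   (≡[p]⇒≈ (g≈0 i j (≤-<-trans (m≤n+m e d) d+e<i+j))))

  isPoly-scale : ∀ c {f} → IsPoly p f → IsPoly p (scale c f)
  isPoly-scale c (d , f≈0) = d , λ i j d<i+j → ≈⇒≡[p] (*-zeroʳ-≈ c (≡[p]⇒≈ (f≈0 i j d<i+j)))

  isPoly-*P : ∀ {f g} → IsPoly p f → IsPoly p g → IsPoly p (f *P g)
  isPoly-*P {f} {g} (d , f≈0) (e , g≈0) = d + e , λ i j d+e<i+j → ≈⇒≡[p]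
    (≈-trans (≈-reflexive (*P-coeff f g i j)) (sumBox-≈0 i j (λ a b a≤i b≤j → term≈0 a b a≤i b≤j d+e<i+j)))
    where
      term≈0 : ∀ {i j} a b → a ≤ i → b ≤ j → d + e < i + j → f a b * g (i ∸ a) (j ∸ b) ≈ 0
      term≈0 {i} {j} a b a≤i b≤j d+e<i+j with d <? a + b
      ... | yes d<a+b = *-zeroˡ-≈ (g (i ∸ a) (j ∸ b)) (≡[p]⇒≈ (f≈0 a b d<a+b))
      ... | no d≮a+b  = *-zeroʳ-≈ (f a b) (≡[p]⇒≈ (g≈0 (i ∸ a) (j ∸ b) (+-cancelˡ-< (a + b) e _ (begin-strict
            a + b + e                    ≤⟨ +-monoˡ-≤ e (≮⇒≥ d≮a+b) ⟩
            d + e                        <⟨ d+e<i+j ⟩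
            i + j                        ≡⟨ cong₂ _+_ (m+[n∸m]≡n a≤i) (m+[n∸m]≡n b≤j) ⟨
            (a + (i ∸ a)) + (b + (j ∸ b)) ≡⟨ +-assoc-interchange a (i ∸ a) b (j ∸ b) ⟩
            a + b + ((i ∸ a) + (j ∸ b))  ∎))))
        where
          open ≤-Reasoning
          +-assoc-interchange : ∀ w x y z → (w + x) + (y + z) ≡ w + y + (x + z)
          +-assoc-interchange = solve-∀

  isPoly-unshift : ∀ a b {f} → IsPoly p f → IsPoly p (unshift a b f)
  isPoly-unshift a b (d , f≈0) = d , λ i j d<i+j → f≈0 (i + a) (j + b) (<-≤-trans d<i+j (+-mono-≤ (m≤m+n i a) (m≤m+n j b)))

  monomial∣⇒vanishes : ∀ {a b F f} → F ≐ monomial a b → Divides p F f → ∀ i j → i < a ⊎ j < b → f i j ≈ 0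
  monomial∣⇒vanishes {a} {b} F≐x^ay^b (h , _ , f≈Fh) i j outside =
    ≈-trans (≡[p]⇒≈ (f≈Fh i j)) (≈-reflexive (trans (monomial-*P h F≐x^ay^b i j) (shift-outside {a} {b} {i} {j} h outside)))

  shift-unshift-≈ : ∀ a b {f} → (∀ i j → i < a ⊎ j < b → f i j ≈ 0) → shift a b (unshift a b f) ≈P f
  shift-unshift-≈ a b {f} f≈0 i j with a ≤? i | b ≤? j
  ... | yes a≤i | yes b≤j = ≈-reflexive (shift-unshift a b f {i} {j} a≤i b≤j)
  ... | no a≰i  | _       = ≈-trans (≈-reflexive (shift-outside {a} {b} {i} {j} (unshift a b f) (inj₁ (≰⇒> a≰i))))
                                    (≈-sym (f≈0 i j (inj₁ (≰⇒> a≰i))))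
  ... | yes _   | no b≰j  = ≈-trans (≈-reflexive (shift-outside {a} {b} {i} {j} (unshift a b f) (inj₂ (≰⇒> b≰j))))
                                    (≈-sym (f≈0 i j (inj₂ (≰⇒> b≰j))))

  vanishes⇒monomial∣ : ∀ {a b F f} → F ≐ monomial a b → IsPoly p f → (∀ i j → i < a ⊎ j < b → f i j ≈ 0) → Divides p F f
  vanishes⇒monomial∣ {a} {b} {F} {f} F≐x^ay^b f-poly f≈0 = unshift a b f , isPoly-unshift a b f-poly , λ i j →
    ≈⇒≡[p] (≈-trans (≈-sym (shift-unshift-≈ a b f≈0 i j)) (≈-reflexive (sym (monomial-*P (unshift a b f) F≐x^ay^b i j))))

  binom-cancel : ∀ m a → a *P binom m ≈P 0P → a ≈P 0P
  binom-cancel m a a*binom≈0 i = <-rec (λ i → ∀ j → a i j ≈ 0) row≈0 i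
    where
      row≈0 : ∀ i → (∀ {u} → u < i → ∀ v → a u v ≈ 0) → ∀ j → a i j ≈ 0
      row≈0 i lower≈0 j = begin
        a i j                                        ≈⟨ +-cong lower-rows≈0 (≈-refl {a i j}) ⟨
        sumBelow i _ + a i j                         ≡⟨ binom-top-coeff m a i j ⟨
        (a *P binom m) i (j + m)                     ≈⟨ a*binom≈0 i (j + m) ⟩
        0                                            ∎
        where
          open ≈-Reasoning
          lower-rows≈0 = sumBelow-≈0 i (λ u u<i → sumBelow-≈0 (suc (j + m)) (λ v _ → *-zeroˡ-≈ (binom m (i ∸ u) (j + m ∸ v)) (lower≈0 u<i v)))

module BasisCriterion (p-1 m μ₁ μ₂ : ℕ) where

  open Congruence p-1
  open PolynomialsModulo p-1

  CornerBinomialsVanish : Set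
  CornerBinomialsVanish = ∀ i j → i + j ≡ m → i < μ₁ → j < μ₂ → m C i ≈ 0

  N : Pol
  N = (X ^P μ₁) *P (Y ^P μ₂)

  N≐monomial : N ≐ monomial μ₁ μ₂
  N≐monomial = X^P*Y^P≐monomial μ₁ μ₂

  ψʸ-vanishes : CornerBinomialsVanish → ∀ i j → j < μ₂ → ψʸ m μ₁ i j ≈ 0
  ψʸ-vanishes corner i j j<μ₂ with i <? μ₁
  ... | no i≮μ₁ = ≈-reflexive (ψʸ-above m μ₁ i j (≮⇒≥ i≮μ₁))
  ... | yes i<μ₁ with i + j ≟ m
  ...   | yes i+j≡m = ≈-trans (≈-reflexive (ψʸ-below m μ₁ i j i<μ₁)) (*-zeroʳ-≈ (δ (i + j) m) (corner i j i+j≡m i<μ₁ j<μ₂))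
  ...   | no i+j≢m  = ≈-reflexive (trans (ψʸ-below m μ₁ i j i<μ₁) (binom-degree m i j i+j≢m))

  ψ∈D : CornerBinomialsVanish → InD p μ₁ μ₂ m (ψ m μ₁)
  ψ∈D corner =
    isPoly-ψˣ m μ₁ , isPoly-ψʸ m μ₁ ,
    vanishes⇒monomial∣ (X^P≐monomial μ₁) (isPoly-ψˣ m μ₁) (λ where i j (inj₁ i<μ₁) → ≈-reflexive (ψˣ-below m μ₁ i j i<μ₁)) ,
    vanishes⇒monomial∣ (Y^P≐monomial μ₂) (isPoly-ψʸ m μ₁) (λ where i j (inj₂ j<μ₂) → ψʸ-vanishes corner i j j<μ₂) ,
    (mono 0 0 , isPoly-monomial (mono≐monomial 0 0) , λ i j → ≈⇒≡[p] (≈-reflexive (begin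
      ψˣ m μ₁ i j + ψʸ m μ₁ i j   ≡⟨ ψ-sum m μ₁ i j ⟩
      binom m i j                 ≡⟨ XY^P≐binom m i j ⟨
      (XY ^P m) i j               ≡⟨ *P-one (XY ^P m) i j ⟨
      ((XY ^P m) *P mono 0 0) i j ∎)))
    where open ≡-Reasoning

  ψ′∈D : InD p μ₁ μ₂ m (ψ' p μ₁ μ₂)
  ψ′∈D =
    isPoly-scale p-1 N-poly , N-poly ,
    vanishes⇒monomial∣ (X^P≐monomial μ₁) (isPoly-scale p-1 N-poly)
      (λ where i j (inj₁ i<μ₁) → ≈-reflexive (trans (cong (p-1 *_) (N-outside (inj₁ i<μ₁))) (*-zeroʳ p-1))) ,
    vanishes⇒monomial∣ (Y^P≐monomial μ₂) N-poly (λ where i j (inj₂ j<μ₂) → ≈-reflexive (N-outside (inj₂ j<μ₂))) ,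
    (0P , isPoly-0P , λ i j → ≈⇒≡[p] (≈-trans (p-1*x+x≈0 (N i j)) (≈-reflexive (sym (*P-zeroʳ (XY ^P m) i j)))))
    where
      N-poly : IsPoly p N
      N-poly = isPoly-monomial N≐monomial
      N-outside : ∀ {i j} → i < μ₁ ⊎ j < μ₂ → N i j ≡ 0
      N-outside {i} {j} outside = trans (N≐monomial i j) (monomial-outside outside)

  ψ-ψ′-span : CornerBinomialsVanish → ∀ θ → InD p μ₁ μ₂ m θ →
              ∃[ a ] ∃[ b ] (IsPoly p a × IsPoly p b × θ ≈D[ p ] comb a b (ψ m μ₁) (ψ' p μ₁ μ₂))
  ψ-ψ′-span corner (f , g) (_ , g-poly , x^μ₁∣f , y^μ₂∣g , (c , c-poly , f+g≈binom*c)) =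
    c , b , c-poly , isPoly-unshift μ₁ μ₂ r-poly , ≈P⇒≈[p] x-part , ≈P⇒≈[p] y-part
    where
      A B r b : Pol
      A = c *P ψˣ m μ₁
      B = c *P ψʸ m μ₁
      r = g +P scale p-1 B
      b = unshift μ₁ μ₂ r

      r-poly : IsPoly p r
      r-poly = isPoly-+P g-poly (isPoly-scale p-1 (isPoly-*P c-poly (isPoly-ψʸ m μ₁)))

      f+g≈A+B : ∀ i j → f i j + g i j ≈ A i j + B i j
      f+g≈A+B i j = ≈-trans (≡[p]⇒≈ (f+g≈binom*c i j)) (≈-reflexive (begin
        ((XY ^P m) *P c) i j                 ≡⟨ *P-comm (XY ^P m) c i j ⟩
        (c *P (XY ^P m)) i j                 ≡⟨ *P-congʳ c (λ i′ j′ → trans (XY^P≐binom m i′ j′) (sym (ψ-sum m μ₁ i′ j′))) i j ⟩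
        (c *P (ψˣ m μ₁ +P ψʸ m μ₁)) i j      ≡⟨ *P-distribˡ-+P c (ψˣ m μ₁) (ψʸ m μ₁) i j ⟩
        A i j + B i j                        ∎))
        where open ≡-Reasoning

      r-vanishes : ∀ i j → i < μ₁ ⊎ j < μ₂ → r i j ≈ 0
      r-vanishes i j (inj₂ j<μ₂) =
        +-cong (monomial∣⇒vanishes (Y^P≐monomial μ₂) y^μ₂∣g i j (inj₂ j<μ₂))
               (*-zeroʳ-≈ p-1 (*P-vanishesʸ c μ₂ (λ k l l<μ₂ → ψʸ-vanishes corner k l l<μ₂) i j j<μ₂))
      r-vanishes i j (inj₁ i<μ₁) = ≈⇒−≈0 (begin
        g i j            ≈⟨ +-cong f≈0 (≈-refl {g i j}) ⟨
        f i j + g i j    ≈⟨ f+g≈A+B i j ⟩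
        A i j + B i j    ≈⟨ +-cong A≈0 (≈-refl {B i j}) ⟩
        B i j            ∎)
        where
          open ≈-Reasoning
          f≈0 = monomial∣⇒vanishes (X^P≐monomial μ₁) x^μ₁∣f i j (inj₁ i<μ₁)
          A≈0 = *P-vanishesˣ c μ₁ (λ k l k<μ₁ → ≈-reflexive (ψˣ-below m μ₁ k l k<μ₁)) i j i<μ₁

      b*N≈r : b *P N ≈P r
      b*N≈r i j = ≈-trans (≈-reflexive (trans (*P-comm b N i j) (monomial-*P b N≐monomial i j)))
                          (shift-unshift-≈ μ₁ μ₂ r-vanishes i j)

      y-part : g ≈P (c *P ψʸ m μ₁) +P (b *P N)
      y-part i j = ≈-sym (≈-trans (+-cong (≈-refl {B i j}) (b*N≈r i j)) (+-−-≈ (g i j) (B i j)))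

      x-part : f ≈P (c *P ψˣ m μ₁) +P (b *P scale p-1 N)
      x-part i j = ≈-sym (begin
        A i j + (b *P scale p-1 N) i j       ≡⟨ cong (A i j +_) (b*[−N]≐−[b*N] i j) ⟩
        A i j − (b *P N) i j                 ≈⟨ +-cong (≈-refl {A i j}) (*-cong (≈-refl {p-1}) (b*N≈r i j)) ⟩
        A i j − (g i j − B i j)              ≈⟨ −-swap-≈ (f+g≈A+B i j) ⟩
        f i j                                ∎)
        where
          open ≈-Reasoning
          b*[−N]≐−[b*N] : b *P scale p-1 N ≐ scale p-1 (b *P N)
          b*[−N]≐−[b*N] i j = trans (*P-comm b (scale p-1 N) i j) (trans (scale-*P p-1 N b i j) (cong (p-1 *_) (*P-comm N b i j)))

  -- Adding the two components turns a ψ + b ψ′ into a (x+y)^m, since ψ′ contributes −N + N.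
  ψ-ψ′-independent : ∀ a b → IsPoly p a → IsPoly p b → comb a b (ψ m μ₁) (ψ' p μ₁ μ₂) ≈D[ p ] (0P , 0P) →
                     (a ≈[ p ] 0P) × (b ≈[ p ] 0P)
  ψ-ψ′-independent a b _ _ (x-part≈0 , y-part≈0) = ≈P⇒≈[p] a≈0 , ≈P⇒≈[p] b≈0
    where
      b*ψ′≈0 : ∀ i j → (b *P scale p-1 N) i j + (b *P N) i j ≈ 0
      b*ψ′≈0 i j = begin
        (b *P scale p-1 N) i j + (b *P N) i j    ≡⟨ *P-distribˡ-+P b (scale p-1 N) N i j ⟨
        (b *P (scale p-1 N +P N)) i j            ≈⟨ *P-congʳ-≈ b (λ i′ j′ → p-1*x+x≈0 (N i′ j′)) i j ⟩
        (b *P 0P) i j                            ≡⟨ *P-zeroʳ b i j ⟩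
        0                                        ∎
        where open ≈-Reasoning

      a*binom≈0 : a *P binom m ≈P 0P
      a*binom≈0 i j = begin
        (a *P binom m) i j                                 ≡⟨ *P-congʳ a (λ i′ j′ → sym (ψ-sum m μ₁ i′ j′)) i j ⟩
        (a *P (ψˣ m μ₁ +P ψʸ m μ₁)) i j                    ≡⟨ *P-distribˡ-+P a (ψˣ m μ₁) (ψʸ m μ₁) i j ⟩
        aψˣ + aψʸ                                          ≈⟨ +-≈0ʳ (aψˣ + aψʸ) (b*ψ′≈0 i j) ⟨
        aψˣ + aψʸ + (bψ′ˣ + bψ′ʸ)                          ≡⟨ interchange aψˣ aψʸ bψ′ˣ bψ′ʸ ⟩
        (aψˣ + bψ′ˣ) + (aψʸ + bψ′ʸ)                        ≈⟨ +-cong (≡[p]⇒≈ (x-part≈0 i j)) (≡[p]⇒≈ (y-part≈0 i j)) ⟩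
        0                                                  ∎
        where
          open ≈-Reasoning
          aψˣ = (a *P ψˣ m μ₁) i j
          aψʸ = (a *P ψʸ m μ₁) i j
          bψ′ˣ = (b *P scale p-1 N) i j
          bψ′ʸ = (b *P N) i j
          interchange : ∀ w x y z → w + x + (y + z) ≡ (w + y) + (x + z)
          interchange = solve-∀

      a≈0 : a ≈P 0P
      a≈0 = binom-cancel m a a*binom≈0

      b*N≈0 : b *P N ≈P 0P
      b*N≈0 i j = begin
        (b *P N) i j                             ≈⟨ +-cong a*ψʸ≈0 (≈-refl {(b *P N) i j}) ⟨
        (a *P ψʸ m μ₁) i j + (b *P N) i j        ≈⟨ ≡[p]⇒≈ (y-part≈0 i j) ⟩
        0                                        ∎
        where
          open ≈-Reasoning
          a*ψʸ≈0 : (a *P ψʸ m μ₁) i j ≈ 0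
          a*ψʸ≈0 = ≈-trans (*P-congˡ-≈ (ψʸ m μ₁) a≈0 i j)
                           (≈-reflexive (trans (*P-comm 0P (ψʸ m μ₁) i j) (*P-zeroʳ (ψʸ m μ₁) i j)))

      b≈0 : b ≈P 0P
      b≈0 i j = begin
        b i j                                    ≡⟨ unshift-shift μ₁ μ₂ b i j ⟨
        shift μ₁ μ₂ b (i + μ₁) (j + μ₂)          ≡⟨ monomial-*P b N≐monomial (i + μ₁) (j + μ₂) ⟨
        (N *P b) (i + μ₁) (j + μ₂)               ≡⟨ *P-comm N b (i + μ₁) (j + μ₂) ⟩
        (b *P N) (i + μ₁) (j + μ₂)               ≈⟨ b*N≈0 (i + μ₁) (j + μ₂) ⟩
        0                                        ∎
        where open ≈-Reasoning

  InΓ⇒CornerBinomialsVanish : InΓ p m μ₁ μ₂ → CornerBinomialsVanish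
  InΓ⇒CornerBinomialsVanish ((_ , _ , _ , y^μ₂∣ψʸ , _) , _) i j i+j≡m i<μ₁ j<μ₂ = begin
    m C i                    ≡⟨ *-identityˡ (m C i) ⟨
    1 * (m C i)              ≡⟨ cong (_* (m C i)) (δ-refl m) ⟨
    δ m m * (m C i)          ≡⟨ cong (λ n → δ n m * (m C i)) i+j≡m ⟨
    binom m i j              ≡⟨ ψʸ-below m μ₁ i j i<μ₁ ⟨
    ψʸ m μ₁ i j              ≈⟨ monomial∣⇒vanishes (Y^P≐monomial μ₂) y^μ₂∣ψʸ i j (inj₂ j<μ₂) ⟩
    0                        ∎
    where open ≈-Reasoning

  InΓ⇔CornerBinomialsVanish : InΓ p m μ₁ μ₂ ⇔ CornerBinomialsVanish
  InΓ⇔CornerBinomialsVanish = mk⇔ InΓ⇒CornerBinomialsVanish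
    (λ corner → ψ∈D corner , ψ′∈D , ψ-ψ′-span corner , ψ-ψ′-independent)

-- Sorted enumerations and staircases

nth-∈ : ∀ (l : List ℕ) {i} → i < length l → nth l i ∈ l
nth-∈ (x ∷ l) {zero}  _         = here refl
nth-∈ (x ∷ l) {suc i} (s≤s i<n) = there (nth-∈ l i<n)

∈⇒nth : ∀ {x} (l : List ℕ) → x ∈ l → ∃[ i ] (i < length l × nth l i ≡ x)
∈⇒nth (y ∷ l) (here x≡y) = 0 , s≤s z≤n , sym x≡y
∈⇒nth (y ∷ l) (there x∈l) with ∈⇒nth l x∈l
... | i , i<n , lᵢ≡x = suc i , s≤s i<n , lᵢ≡x

nth-beyond : ∀ (l : List ℕ) {i} → length l ≤ i → nth l i ≡ 0
nth-beyond []      _         = refl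
nth-beyond (x ∷ l) (s≤s n≤i) = nth-beyond l n≤i

nth-strictMono : ∀ {l : List ℕ} → Linked _<_ l → ∀ {i j} → i < j → j < length l → nth l i < nth l j
nth-strictMono (x<y ∷ sorted) {zero}  {suc zero}    _         _         = x<y
nth-strictMono (x<y ∷ sorted) {zero}  {suc (suc j)} _         (s≤s j<n) = <-trans x<y (nth-strictMono sorted (s≤s z≤n) j<n)
nth-strictMono (x<y ∷ sorted) {suc i} {suc j}       (s≤s i<j) (s≤s j<n) = nth-strictMono sorted i<j j<n
nth-strictMono [-]            {zero}  {suc j}       _         (s≤s ())
nth-strictMono [-]            {suc i} {suc j}       _         (s≤s ())

nth-mono : ∀ {l : List ℕ} → Linked _<_ l → ∀ {i j} → i ≤ j → j < length l → nth l i ≤ nth l j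
nth-mono sorted i≤j j<n with m≤n⇒m<n∨m≡n i≤j
... | inj₁ i<j  = <⇒≤ (nth-strictMono sorted i<j j<n)
... | inj₂ refl = ≤-refl

nth-reflect-< : ∀ {l : List ℕ} → Linked _<_ l → ∀ {i j} → i < length l → nth l i < nth l j → i < j
nth-reflect-< sorted {i} {j} i<n lᵢ<lⱼ with i <? j
... | yes i<j = i<j
... | no i≮j  = ⊥-elim (<⇒≱ lᵢ<lⱼ (nth-mono sorted (≮⇒≥ i≮j) i<n))

antitone-reverses : ∀ t (σ : ℕ → ℕ) → σ 0 ≤ t → (∀ {i} → i < t → σ (suc i) < σ i) → ∀ {i} → i ≤ t → σ i ≡ t ∸ i
antitone-reverses t σ σ0≤t σ-decreasing {i} i≤t =
  ≤-antisym (m+n≤o⇒m≤o∸n (σ i) (upper i≤t)) (lower (t ∸ i) i (m+[n∸m]≡n i≤t))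
  where
    upper : ∀ {i} → i ≤ t → σ i + i ≤ t
    upper {zero}  _     = subst (_≤ t) (sym (+-identityʳ (σ 0))) σ0≤t
    upper {suc i} 1+i≤t = begin
      σ (suc i) + suc i   ≡⟨ +-suc (σ (suc i)) i ⟩
      suc (σ (suc i)) + i ≤⟨ +-monoˡ-≤ i (σ-decreasing 1+i≤t) ⟩
      σ i + i             ≤⟨ upper (<⇒≤ 1+i≤t) ⟩
      t                   ∎
      where open ≤-Reasoning
    lower : ∀ d i → i + d ≡ t → d ≤ σ i
    lower zero    i _       = z≤n
    lower (suc d) i i+1+d≡t = ≤-trans (s≤s (lower d (suc i) (trans (sym (+-suc i d)) i+1+d≡t)))
                                      (σ-decreasing (subst (i <_) i+1+d≡t (m<m+n i (s≤s z≤n))))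

Admissible : ℕ → (ℕ → Set) → ℕ → ℕ → Set
Admissible m G μ₁ μ₂ = ∀ x → G x → x < μ₁ → μ₂ + x ≤ m

Maximal : (ℕ → ℕ → Set) → ℕ → ℕ → Set
Maximal R μ₁ μ₂ = R μ₁ μ₂ × (∀ ν₁ ν₂ → R ν₁ ν₂ → μ₁ ≤ ν₁ → μ₂ ≤ ν₂ → ν₁ ≡ μ₁ × ν₂ ≡ μ₂)

Maximal-cong : ∀ {R R′ : ℕ → ℕ → Set} → (∀ a b → R a b ⇔ R′ a b) → ∀ a b → Maximal R a b ⇔ Maximal R′ a b
Maximal-cong R⇔R′ a b = mk⇔
  (λ (Rab , max) → Equivalence.to (R⇔R′ a b) Rab , λ c d R′cd → max c d (Equivalence.from (R⇔R′ c d) R′cd))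
  (λ (R′ab , max) → Equivalence.from (R⇔R′ a b) R′ab , λ c d Rcd → max c d (Equivalence.to (R⇔R′ c d) Rcd))

module Staircase (m : ℕ) (G : ℕ → Set) (x₀ : ℕ) (xs : List ℕ)
                 (sorted : Linked _<_ (x₀ ∷ xs)) (enumerates : ∀ x → (x ∈ x₀ ∷ xs) ⇔ G x)
                 (G-zero : G 0) (G-top : G m) (G-bounded : ∀ {x} → G x → x ≤ m) where

  gs : List ℕ
  gs = x₀ ∷ xs

  t : ℕ
  t = length xs

  g : ℕ → ℕ
  g = nth gs

  -- Beyond the end of the list nth returns 0, which lies in G as well.
  G-g : ∀ k → G (g k)
  G-g k with k ≤? t
  ... | yes k≤t = Equivalence.to (enumerates (g k)) (nth-∈ gs (s≤s k≤t))
  ... | no k≰t  = subst G (sym (nth-beyond gs (≰⇒> k≰t))) G-zero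

  index : ∀ {x} → G x → ∃[ k ] (k ≤ t × g k ≡ x)
  index {x} Gx with ∈⇒nth gs (Equivalence.from (enumerates x) Gx)
  ... | k , s≤s k≤t , gk≡x = k , k≤t , gk≡x

  g-strictMono : ∀ {i j} → i < j → j ≤ t → g i < g j
  g-strictMono i<j j≤t = nth-strictMono sorted i<j (s≤s j≤t)

  g-mono : ∀ {i j} → i ≤ j → j ≤ t → g i ≤ g j
  g-mono i≤j j≤t = nth-mono sorted i≤j (s≤s j≤t)

  g-reflect-< : ∀ {i j} → i ≤ t → g i < g j → i < j
  g-reflect-< i≤t = nth-reflect-< sorted (s≤s i≤t)

  g-zero : g 0 ≡ 0
  g-zero with index G-zero
  ... | k , k≤t , gk≡0 = n≤0⇒n≡0 (subst (g 0 ≤_) gk≡0 (g-mono z≤n k≤t))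

  g-top : g t ≡ m
  g-top with index G-top
  ... | k , k≤t , gk≡m = ≤-antisym (G-bounded (G-g t)) (subst (_≤ g t) gk≡m (g-mono k≤t ≤-refl))

  G-below-step : ∀ {k x} → k ≤ t → G x → k ≡ t ⊎ x < g (suc k) → x ≤ g k
  G-below-step {k} k≤t Gx bound with index Gx
  ... | j , j≤t , refl with j ≤? k
  ...   | yes j≤k = g-mono j≤k k≤t
  ...   | no j≰k with bound
  ...     | inj₁ refl         = ⊥-elim (j≰k j≤t)
  ...     | inj₂ gj<g[1+k]    = ⊥-elim (<⇒≱ gj<g[1+k] (g-mono (≰⇒> j≰k) j≤t))

  admissible-step : ∀ {k μ₁} → k ≤ t → k ≡ t ⊎ μ₁ ≤ g (suc k) → Admissible m G μ₁ (m ∸ g k)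
  admissible-step {k} k≤t bound x Gx x<μ₁ = begin
    m ∸ g k + x    ≤⟨ +-monoʳ-≤ (m ∸ g k) (G-below-step k≤t Gx (Data.Sum.map₂ (<-≤-trans x<μ₁) bound)) ⟩
    m ∸ g k + g k  ≡⟨ m∸n+n≡m (G-bounded (G-g k)) ⟩
    m              ∎
    where open ≤-Reasoning

  IsCorner : ℕ → ℕ → Set
  IsCorner μ₁ μ₂ = ∃[ k ] (k < t × μ₁ ≡ g (suc k) × μ₂ ≡ m ∸ g k)

  corner⇒maximal : ∀ {μ₁ μ₂} → IsCorner μ₁ μ₂ → Maximal (Admissible m G) μ₁ μ₂
  corner⇒maximal (k , k<t , refl , refl) = admissible-step (<⇒≤ k<t) (inj₂ ≤-refl) , maximal
    where
      maximal : ∀ ν₁ ν₂ → Admissible m G ν₁ ν₂ → g (suc k) ≤ ν₁ → m ∸ g k ≤ ν₂ → ν₁ ≡ g (suc k) × ν₂ ≡ m ∸ g k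
      maximal ν₁ ν₂ admissible g[1+k]≤ν₁ m∸gk≤ν₂ = ν₁≡ , ν₂≡
        where
          gk<g[1+k] = g-strictMono ≤-refl k<t
          ν₂≡ : ν₂ ≡ m ∸ g k
          ν₂≡ = ≤-antisym (m+n≤o⇒m≤o∸n ν₂ (admissible (g k) (G-g k) (<-≤-trans gk<g[1+k] g[1+k]≤ν₁))) m∸gk≤ν₂
          ν₁≡ : ν₁ ≡ g (suc k)
          ν₁≡ with g (suc k) <? ν₁
          ... | no g[1+k]≮ν₁ = ≤-antisym (≮⇒≥ g[1+k]≮ν₁) g[1+k]≤ν₁
          ... | yes g[1+k]<ν₁ = ⊥-elim (<⇒≱ (begin-strict
                m                    ≡⟨ m∸n+n≡m (G-bounded (G-g k)) ⟨
                m ∸ g k + g k        <⟨ +-monoʳ-< (m ∸ g k) gk<g[1+k] ⟩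
                m ∸ g k + g (suc k)  ≡⟨ cong (_+ g (suc k)) ν₂≡ ⟨
                ν₂ + g (suc k)       ∎) (admissible (g (suc k)) (G-g (suc k)) g[1+k]<ν₁))
            where open ≤-Reasoning

  last-below : ∀ μ → 0 < μ → ∃[ k ] (k ≤ t × g k < μ × (k ≡ t ⊎ (k < t × μ ≤ g (suc k))))
  last-below μ 0<μ = scan t 0 refl (subst (_< μ) (sym g-zero) 0<μ)
    where
      scan : ∀ d k → k + d ≡ t → g k < μ → ∃[ k ] (k ≤ t × g k < μ × (k ≡ t ⊎ (k < t × μ ≤ g (suc k))))
      scan zero    k k+0≡t gk<μ = k , ≤-reflexive k≡t , gk<μ , inj₁ k≡t
        where k≡t = trans (sym (+-identityʳ k)) k+0≡t
      scan (suc d) k k+1+d≡t gk<μ with μ ≤? g (suc k)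
      ... | yes μ≤g[1+k] = k , <⇒≤ k<t , gk<μ , inj₂ (k<t , μ≤g[1+k])
        where k<t = subst (k <_) k+1+d≡t (m<m+n k (s≤s z≤n))
      ... | no μ≰g[1+k]  = scan d (suc k) (trans (sym (+-suc k d)) k+1+d≡t) (≰⇒> μ≰g[1+k])

  maximal⇒corner : ∀ {μ₁ μ₂} → Maximal (Admissible m G) μ₁ μ₂ → IsCorner μ₁ μ₂
  maximal⇒corner {zero} {μ₂} (_ , maximal) =
    ⊥-elim (1+n≢n (proj₂ (maximal 0 (suc μ₂) (λ _ _ ()) ≤-refl (n≤1+n μ₂))))
  maximal⇒corner {μ₁@(suc _)} {μ₂} (admissible , maximal) with last-below μ₁ (s≤s z≤n)
  ... | k , k≤t , gk<μ₁ , bound = corner bound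
    where
      μ₂≡ : μ₂ ≡ m ∸ g k
      μ₂≡ = sym (proj₂ (maximal μ₁ (m ∸ g k) (admissible-step k≤t (Data.Sum.map₂ proj₂ bound)) ≤-refl
                                (m+n≤o⇒m≤o∸n μ₂ (admissible (g k) (G-g k) gk<μ₁))))
      corner : k ≡ t ⊎ (k < t × μ₁ ≤ g (suc k)) → IsCorner μ₁ μ₂
      corner (inj₁ refl) = ⊥-elim (1+n≢n (proj₁ (maximal (suc μ₁) μ₂ admissible′ (n≤1+n μ₁) ≤-refl)))
        where
          admissible′ : Admissible m G (suc μ₁) μ₂
          admissible′ x Gx _ = subst (λ μ → μ + x ≤ m) (sym (trans μ₂≡ (trans (cong (m ∸_) g-top) (n∸n≡0 m)))) (G-bounded Gx)
      corner (inj₂ (k<t , μ₁≤g[1+k])) = k , k<t , sym g[1+k]≡μ₁ , μ₂≡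
        where
          g[1+k]≡μ₁ : g (suc k) ≡ μ₁
          g[1+k]≡μ₁ = proj₁ (maximal (g (suc k)) μ₂ admissible′ μ₁≤g[1+k] ≤-refl)
            where
              admissible′ : Admissible m G (g (suc k)) μ₂
              admissible′ = subst (Admissible m G (g (suc k))) (sym μ₂≡) (admissible-step k≤t (inj₂ ≤-refl))

  maximal⇔corner : ∀ μ₁ μ₂ → Maximal (Admissible m G) μ₁ μ₂ ⇔ IsCorner μ₁ μ₂
  maximal⇔corner μ₁ μ₂ = mk⇔ maximal⇒corner corner⇒maximal

  module Symmetric (G-complement : ∀ {x} → G x → G (m ∸ x)) where

    σ : ℕ → ℕ
    σ k = proj₁ (index (G-complement (G-g k)))

    g∘σ : ∀ k → g (σ k) ≡ m ∸ g k
    g∘σ k = proj₂ (proj₂ (index (G-complement (G-g k))))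

    σ≤t : ∀ k → σ k ≤ t
    σ≤t k = proj₁ (proj₂ (index (G-complement (G-g k))))

    σ-decreasing : ∀ {k} → k < t → σ (suc k) < σ k
    σ-decreasing {k} k<t = g-reflect-< (σ≤t (suc k)) (subst₂ _<_ (sym (g∘σ (suc k))) (sym (g∘σ k))
      (∸-monoʳ-< (g-strictMono ≤-refl k<t) (G-bounded (G-g (suc k)))))

    g-complement : ∀ {k} → k ≤ t → g (t ∸ k) ≡ m ∸ g k
    g-complement {k} k≤t = trans (cong g (sym (antitone-reverses t σ (σ≤t 0) σ-decreasing k≤t))) (g∘σ k)

    corner⇔InS : ∀ μ₁ μ₂ → IsCorner μ₁ μ₂ ⇔ InS gs μ₁ μ₂
    corner⇔InS μ₁ μ₂ = mk⇔
      (λ (k , k<t , μ₁≡ , μ₂≡) → suc k , s≤s z≤n , k<t , μ₁≡ , trans μ₂≡ (mirror k<t))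
      (λ where (suc k , _ , k<t , μ₁≡ , μ₂≡) → k , k<t , μ₁≡ , trans μ₂≡ (sym (mirror k<t)))
      where
        mirror : ∀ {k} → k < t → m ∸ g k ≡ g (t + 1 ∸ suc k)
        mirror {k} k<t = trans (sym (g-complement (<⇒≤ k<t))) (cong (λ n → g (n ∸ suc k)) (+-comm 1 t))

module DigitCriterion (p-1 : ℕ) (p-prime : Prime (suc p-1)) (m μ₁ μ₂ : ℕ) where

  open Congruence p-1
  open Lucas p-1 p-prime
  open BasisCriterion p-1 m μ₁ μ₂

  corner⇔admissible : CornerBinomialsVanish ⇔ Admissible m (InG p m) μ₁ μ₂
  corner⇔admissible = mk⇔ to from
    where
      to : CornerBinomialsVanish → Admissible m (InG p m) μ₁ μ₂
      to corner x x≼m x<μ₁ with μ₂ + x ≤? m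
      ... | yes μ₂+x≤m = μ₂+x≤m
      ... | no μ₂+x≰m  = ⊥-elim (Equivalence.from (C≉0⇔InG m x) x≼m (corner x (m ∸ x) (m+[n∸m]≡n x≤m) x<μ₁ m∸x<μ₂))
        where
          x≤m = InG⇒≤ x≼m
          m∸x<μ₂ : m ∸ x < μ₂
          m∸x<μ₂ = +-cancelʳ-< x (m ∸ x) μ₂ (subst (_< μ₂ + x) (sym (m∸n+n≡m x≤m)) (≰⇒> μ₂+x≰m))
      from : Admissible m (InG p m) μ₁ μ₂ → CornerBinomialsVanish
      from admissible i j i+j≡m i<μ₁ j<μ₂ with ≈0? (m C i)
      ... | yes mCi≈0 = mCi≈0
      ... | no mCi≉0  = ⊥-elim (<⇒≱ j<μ₂ (+-cancelʳ-≤ i μ₂ j μ₂+i≤j+i))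
        where
          μ₂+i≤j+i : μ₂ + i ≤ j + i
          μ₂+i≤j+i = subst (μ₂ + i ≤_) (trans (sym i+j≡m) (+-comm i j))
                           (admissible i (Equivalence.to (C≉0⇔InG m i) mCi≉0) i<μ₁)

  InΓ⇔Admissible : InΓ p m μ₁ μ₂ ⇔ Admissible m (InG p m) μ₁ μ₂
  InΓ⇔Admissible = ⇔-trans InΓ⇔CornerBinomialsVanish corner⇔admissible

theorem5p10 : (p : ℕ) .{{_ : NonZero p}} → Prime p →
    (m : ℕ) → 0 < m →
    (gs : List ℕ) → Linked _<_ gs → (∀ g → (g ∈ gs) ⇔ InG p m g) →
    ∀ μ₁ μ₂ → MaximalΓ p m μ₁ μ₂ ⇔ InS gs μ₁ μ₂
theorem5p10 zero p-prime = ⊥-elim (¬prime[0] p-prime)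
theorem5p10 (suc p-1) p-prime m _ [] _ enumerates = ⊥-elim (0∉[] (Equivalence.from (enumerates 0) (InG-zero m)))
  where
    open Lucas p-1 p-prime
    0∉[] : ¬ (0 ∈ [])
    0∉[] ()
theorem5p10 (suc p-1) p-prime m _ (x₀ ∷ xs) sorted enumerates μ₁ μ₂ =
  ⇔-trans (Maximal-cong (DigitCriterion.InΓ⇔Admissible p-1 p-prime m) μ₁ μ₂)
          (⇔-trans (maximal⇔corner μ₁ μ₂) (corner⇔InS μ₁ μ₂))
  where
    open Lucas p-1 p-prime
    open Staircase m (InG (suc p-1) m) x₀ xs sorted enumerates (InG-zero m) (InG-∸ (InG-zero m)) InG⇒≤
    open Symmetric InG-∸
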